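{- Let $G'$ and $G''$ be two cospectral signed graphs, each of order $n$, and let $H_1,\dots,H_n$ be signed graphs with $\chi_{H_1}(\lambda)=\dots=\chi_{H_n}(\lambda)$. Then $G'\circ\Lambda_{l=1}^{n}H_l$ and $G''\circ\Lambda_{l=1}^{n}H_l$ are cospectral.
   Context: A signed graph $G=(V,E,\sigma)$ is a finite simple graph with signature $\sigma:E\to\{+1,-1\}$, considered with its canonical marking $\mu(v)=\prod_{e\ni v}\sigma(e)$ (product over incident edges; empty product $=+1$); $\mu[V]$ is the column vector of markings. $A(G)$ is the signed adjacency matrix, $f_G(\lambda)=\det(\lambda I-A(G))$; two signed graphs are cospectral if they have the same characteristic polynomial $f$. The signed coronal is $\chi_H(\lambda)=\mu[V]^T(\lambda I-A(H))^{ -1}\mu[V]$. Generalized corona product: for $G$ with vertices $v_1,\dots,v_n$, $G\circ\Lambda_{l=1}^{n}H_l$ is obtained from the disjoint union of $G,H_1,\dots,H_n$ by adding, for each $l$, an edge from $v_l$ to every vertex $w$ of $H_l$ with sign $\mu(v_l)\mu_l(w)$, where $\mu,\mu_l$ are the canonical markings of $G,H_l$. -}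

module Defs where

open import Data.Nat using (ℕ; zero; suc; _+_)
open import Data.Fin using (Fin; zero; suc; splitAt; punchIn; toℕ)
open import Data.Fin.Properties using (_≟_)
open import Data.Integer as ℤ using (ℤ; +_; -[1+_])
open import Data.List using (List; []; _∷_; map)
open import Data.Maybe using (Maybe; just; nothing)
open import Data.Product using (Σ; _,_)
open import Data.Sum using (inj₁; inj₂)
open import Data.Sign as Sign using (Sign)
open import Data.Bool using (Bool; true; false; if_then_else_)
open import Relation.Nullary using (yes; no)
open import Relation.Binary.PropositionalEquality using (_≡_; refl)

-- Polynomials over ℤ in one indeterminate λ: coefficient lists,
-- lowest degree first. Equality is coefficientwise (so trailing zeros
-- do not matter).

Poly : Set
Poly = List ℤ

coeff : Poly → ℕ → ℤ
coeff []       _       = + 0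
coeff (a ∷ _)  zero    = a
coeff (_ ∷ p)  (suc k) = coeff p k

infix 4 _≈P_
_≈P_ : Poly → Poly → Set
p ≈P q = ∀ k → coeff p k ≡ coeff q k

infixl 6 _+P_
_+P_ : Poly → Poly → Poly
[]      +P q       = q
(a ∷ p) +P []      = a ∷ p
(a ∷ p) +P (b ∷ q) = (a ℤ.+ b) ∷ (p +P q)

-P_ : Poly → Poly
-P p = map ℤ.-_ p

infixl 7 _*P_
_*P_ : Poly → Poly → Poly
[]      *P q = []
(a ∷ p) *P q = map (a ℤ.*_) q +P (+ 0 ∷ (p *P q))

constP : ℤ → Poly
constP a = a ∷ []

X : Poly
X = + 0 ∷ + 1 ∷ []

sumFin : ∀ {n} → (Fin n → Poly) → Poly
sumFin {zero}  f = []
sumFin {suc n} f = f zero +P sumFin (λ i → f (suc i))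

parity : ℕ → ℤ
parity zero          = + 1
parity (suc zero)    = -[1+ 0 ]
parity (suc (suc k)) = parity k

Mat : ℕ → Set
Mat n = Fin n → Fin n → Poly

minor : ∀ {n} → Fin (suc n) → Fin (suc n) → Mat (suc n) → Mat n
minor r c M i j = M (punchIn r i) (punchIn c j)

det : ∀ n → Mat n → Poly
det zero    M = constP (+ 1)
det (suc n) M =
  sumFin (λ j → constP (parity (toℕ j)) *P M zero j *P det n (minor zero j M))

adjugate : ∀ n → Mat n → Mat n
adjugate (suc n) M u w =
  constP (parity (toℕ u + toℕ w)) *P det n (minor w u M)

signℤ : Sign → ℤ
signℤ Sign.+ = + 1
signℤ Sign.- = -[1+ 0 ]

Edges : ℕ → Set
Edges n = Fin n → Fin n → Maybe Sign

record SignedGraph (n : ℕ) : Set where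
  field
    edge   : Edges n
    sym    : ∀ i j → edge i j ≡ edge j i
    irrefl : ∀ i → edge i i ≡ nothing
open SignedGraph public

markingE : ∀ {n} → Edges n → Fin n → Sign
markingE {n} e v = go (e v)
  where
  go : ∀ {k} → (Fin k → Maybe Sign) → Sign
  go {zero}  f = Sign.+
  go {suc k} f with f zero
  ... | just s  = s Sign.* go (λ i → f (suc i))
  ... | nothing = go (λ i → f (suc i))

marking : ∀ {n} → SignedGraph n → Fin n → Sign
marking G = markingE (edge G)

adjEntry : Maybe Sign → Poly
adjEntry (just s) = constP (signℤ s)
adjEntry nothing  = []

charMat : ∀ {n} → Edges n → Mat n
charMat e i j with i ≟ j
... | yes _ = X +P (-P adjEntry (e i j))
... | no  _ = -P adjEntry (e i j)

charPolyE : ∀ {n} → Edges n → Poly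
charPolyE {n} e = det n (charMat e)

charPoly : ∀ {n} → SignedGraph n → Poly
charPoly G = charPolyE (edge G)

CospectralE : ∀ {n} → Edges n → Edges n → Set
CospectralE e₁ e₂ = charPolyE e₁ ≈P charPolyE e₂

Cospectral : ∀ {n} → SignedGraph n → SignedGraph n → Set
Cospectral G₁ G₂ = charPoly G₁ ≈P charPoly G₂

-- Signed coronal χ_H(λ) = μ^T (λI - A)^{-1} μ = N_H(λ) / f_H(λ), where
-- N_H = μ^T adj(λI - A) μ.  Equality of two coronals as rational
-- functions is N₁ f₂ = N₂ f₁ (the f's are monic, hence nonzero).

coronalNum : ∀ {n} → SignedGraph n → Poly
coronalNum {n} H =
  sumFin (λ u → sumFin (λ w →
    constP (signℤ (marking H u)) *P adjugate n (charMat (edge H)) u w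
      *P constP (signℤ (marking H w))))

SameCoronal : ∀ {m m′} → SignedGraph m → SignedGraph m′ → Set
SameCoronal H₁ H₂ =
  coronalNum H₁ *P charPoly H₂ ≈P coronalNum H₂ *P charPoly H₁

-- Generalized corona product G ∘ Λ_{l=1}^n H_l.
-- Vertex set: Fin (n + total m), the first n vertices are those of G,
-- followed by the vertices of H_0, H_1, ..., H_{n-1} in order.

total : ∀ n → (Fin n → ℕ) → ℕ
total zero    m = 0
total (suc n) m = m zero + total n (λ i → m (suc i))

decode : ∀ n (m : Fin n → ℕ) → Fin (total n m) → Σ (Fin n) (λ l → Fin (m l))
decode (suc n) m k with splitAt (m zero) k
... | inj₁ w  = zero , w
... | inj₂ k′ with decode n (λ i → m (suc i)) k′
...   | l , w = suc l , w

coronaEdges : ∀ {n} (G : SignedGraph n) (m : Fin n → ℕ)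
              (H : (l : Fin n) → SignedGraph (m l)) → Edges (n + total n m)
coronaEdges {n} G m H x y with splitAt n x | splitAt n y
... | inj₁ u | inj₁ v = edge G u v
... | inj₁ u | inj₂ k = gh u (decode n m k)
  where
  gh : Fin n → Σ (Fin n) (λ l → Fin (m l)) → Maybe Sign
  gh u (l , w) with u ≟ l
  ... | yes _ = just (marking G u Sign.* marking (H l) w)
  ... | no  _ = nothing
... | inj₂ k | inj₁ u = gh u (decode n m k)
  where
  gh : Fin n → Σ (Fin n) (λ l → Fin (m l)) → Maybe Sign
  gh u (l , w) with u ≟ l
  ... | yes _ = just (marking G u Sign.* marking (H l) w)
  ... | no  _ = nothing
... | inj₂ k | inj₂ k′ = hh (decode n m k) (decode n m k′)
  where
  hh : Σ (Fin n) (λ l → Fin (m l)) → Σ (Fin n) (λ l → Fin (m l)) → Maybe Sign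
  hh (l , w) (l′ , w′) with l ≟ l′
  ... | yes refl = edge (H l) w w′
  ... | no  _    = nothing

module Submission where

-- Write f_l and N_l for the characteristic polynomial and the coronal
-- numerator of H_l, so that χ_{H_l} = N_l / f_l.  In λI - A of the corona,
-- multiply the row of each vertex l of G by f_l and add to it a combination
-- of the rows of H_l built from the adjugate of λI - A(H_l).  This clears
-- the G×H block and leaves f_l (λI - A(G))_{lj} - δ_{lj} N_l in the G×G
-- block, so ∏ f_l · f_corona = det (f_l (λI - A(G))_{lj} - δ_{lj} N_l) · ∏ f_l.
-- If every χ_{H_l} equals N₀ / f₀, multiplying row l of that matrix by f₀
-- turns it into f_l times f₀ (λI - A(G)) - N₀ I, whose determinant is the
-- degree-n homogenisation of f_G evaluated at (f₀ λ - N₀, f₀); so it only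
-- depends on f_G.  Cancelling the monic factor f₀ⁿ ∏ f_l finishes the proof.

open import Defs hiding (sym)
open import Algebra.Bundles using (AbelianGroup; CommutativeMonoid; CommutativeRing; Monoid; Semiring)
open import Algebra.Structures using (IsAbelianGroup; IsCommutativeRing)
import Algebra.Properties.CommutativeSemigroup as CommSemigroupProperties
open import Data.Empty using (⊥-elim)
open import Data.Fin using (Fin; zero; suc; toℕ; punchIn; punchOut; inject₁; splitAt; _↑ˡ_; _↑ʳ_)
import Data.Fin.Properties as Fin
open import Data.Integer as ℤ using (ℤ; +_; -[1+_])
import Data.Integer.Properties as ℤ
open import Data.List using ([]; _∷_; map; length)
open import Data.Maybe as Maybe using (Maybe; just; nothing)
open import Data.Nat as ℕ using (ℕ; zero; suc; _<_; z≤n; s≤s)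
import Data.Nat.Properties as ℕ
open import Data.Product using (Σ; ∃; _×_; _,_; proj₁; proj₂)
open import Data.Sign as Sign using (Sign)
open import Data.Sum using (_⊎_; inj₁; inj₂; [_,_]′)
open import Data.Vec.Functional using (updateAt)
open import Data.Vec.Functional.Properties using (updateAt-updates; updateAt-minimal; updateAt-id-local)
open import Function using (_∘_; const)
open import Level using (0ℓ)
open import Relation.Binary.PropositionalEquality as ≡ using (_≡_; _≢_; refl; cong; cong₂)
open import Relation.Binary.Structures using (IsEquivalence)
open import Relation.Nullary using (yes; no)
open import Tactic.RingSolver using (solve-∀)
import Tactic.RingSolver.Core.AlmostCommutativeRing as ACR

-- Finite sums in a monoid

module _ {c ℓ} (M : Monoid c ℓ) where
  open Monoid M renaming (refl to ≈-refl)
  open import Algebra.Properties.Monoid.Sum M using (sum)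
  open import Relation.Binary.Reasoning.Setoid setoid

  sum-↑-split : ∀ a b (f : Fin (a ℕ.+ b) → Carrier) →
                sum f ≈ sum (λ i → f (i ↑ˡ b)) ∙ sum (λ j → f (a ↑ʳ j))
  sum-↑-split zero    b f = sym (identityˡ _)
  sum-↑-split (suc a) b f = begin
    f zero ∙ sum (f ∘ suc)                                          ≈⟨ ∙-congˡ (sum-↑-split a b (f ∘ suc)) ⟩
    f zero ∙ (sum (λ i → f (suc (i ↑ˡ b))) ∙ sum (λ j → f (suc (a ↑ʳ j)))) ≈⟨ assoc _ _ _ ⟨
    (f zero ∙ sum (λ i → f (suc (i ↑ˡ b)))) ∙ sum (λ j → f (suc (a ↑ʳ j))) ∎

  sum-ε : ∀ {n} (f : Fin n → Carrier) → (∀ i → f i ≈ ε) → sum f ≈ ε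
  sum-ε {zero}  f f≈ε = ≈-refl
  sum-ε {suc n} f f≈ε = trans (∙-cong (f≈ε zero) (sum-ε (f ∘ suc) (f≈ε ∘ suc))) (identityˡ ε)

  sum-single : ∀ {n} (f : Fin n → Carrier) i → (∀ j → j ≢ i → f j ≈ ε) → sum f ≈ f i
  sum-single {suc n} f zero    f≈ε =
    trans (∙-congˡ (sum-ε (f ∘ suc) (λ j → f≈ε (suc j) λ ()))) (identityʳ (f zero))
  sum-single {suc n} f (suc i) f≈ε =
    trans (∙-cong (f≈ε zero λ ()) (sum-single (f ∘ suc) i λ j j≢i → f≈ε (suc j) (j≢i ∘ Fin.suc-injective)))
          (identityˡ (f (suc i)))

module _ {c ℓ} (M : CommutativeMonoid c ℓ) where
  open CommutativeMonoid M renaming (refl to ≈-refl)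
  open import Algebra.Properties.CommutativeMonoid.Sum M using (sum; ∑-distrib-+)
  open CommSemigroupProperties commutativeSemigroup using (x∙yz≈y∙xz)
  open import Relation.Binary.Reasoning.Setoid setoid

  sum-offDiagonal-transpose : ∀ {n} (F : Fin (suc n) → Fin (suc n) → Carrier) →
    sum (λ j → sum (λ k → F j (punchIn j k))) ≈ sum (λ j → sum (λ k → F (punchIn j k) j))
  sum-offDiagonal-transpose {zero}  F = ≈-refl
  sum-offDiagonal-transpose {suc n} F = begin
    row₀ ∙ sum (λ j → F (suc j) zero ∙ sum (λ k → F′ j (punchIn j k)))
      ≈⟨ ∙-congˡ (∑-distrib-+ (λ j → F (suc j) zero) (λ j → sum (λ k → F′ j (punchIn j k)))) ⟩
    row₀ ∙ (col₀ ∙ sum (λ j → sum (λ k → F′ j (punchIn j k))))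
      ≈⟨ ∙-congˡ (∙-congˡ (sum-offDiagonal-transpose F′)) ⟩
    row₀ ∙ (col₀ ∙ sum (λ j → sum (λ k → F′ (punchIn j k) j)))
      ≈⟨ x∙yz≈y∙xz row₀ col₀ _ ⟩
    col₀ ∙ (row₀ ∙ sum (λ j → sum (λ k → F′ (punchIn j k) j)))
      ≈⟨ ∙-congˡ (∑-distrib-+ (λ j → F zero (suc j)) (λ j → sum (λ k → F′ (punchIn j k) j))) ⟨
    col₀ ∙ sum (λ j → F zero (suc j) ∙ sum (λ k → F′ (punchIn j k) j)) ∎
    where
    F′ : Fin (suc n) → Fin (suc n) → Carrier
    F′ a b = F (suc a) (suc b)
    row₀ col₀ : Carrier
    row₀ = sum (λ k → F zero (suc k))
    col₀ = sum (λ j → F (suc j) zero)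

-- The commutative ring ℤ[λ]

infixr 7 _·P_
_·P_ : ℤ → Poly → Poly
a ·P q = map (a ℤ.*_) q

coeff-+P : ∀ p q k → coeff (p +P q) k ≡ coeff p k ℤ.+ coeff q k
coeff-+P []      q       k       = ≡.sym (ℤ.+-identityˡ _)
coeff-+P (a ∷ p) []      k       = ≡.sym (ℤ.+-identityʳ _)
coeff-+P (a ∷ p) (b ∷ q) zero    = refl
coeff-+P (a ∷ p) (b ∷ q) (suc k) = coeff-+P p q k

coeff--P : ∀ p k → coeff (-P p) k ≡ ℤ.- coeff p k
coeff--P []      k       = refl
coeff--P (a ∷ p) zero    = refl
coeff--P (a ∷ p) (suc k) = coeff--P p k

coeff-·P : ∀ a q k → coeff (a ·P q) k ≡ a ℤ.* coeff q k
coeff-·P a []      k       = ≡.sym (ℤ.*-zeroʳ a)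
coeff-·P a (b ∷ q) zero    = refl
coeff-·P a (b ∷ q) (suc k) = coeff-·P a q k

-- A record rather than ≈P itself, so that both polynomials can be
-- recovered from a proof by unification.
infix 4 _≋_
record _≋_ (p q : Poly) : Set where
  constructor mk≋
  field coeff-≡ : p ≈P q
open _≋_ public

≋-isEquivalence : IsEquivalence _≋_
≋-isEquivalence = record
  { refl  = mk≋ λ _ → refl
  ; sym   = λ (mk≋ e) → mk≋ λ k → ≡.sym (e k)
  ; trans = λ (mk≋ e) (mk≋ f) → mk≋ λ k → ≡.trans (e k) (f k)
  }

private
  module ≋ = IsEquivalence ≋-isEquivalence

  ∷-cong : ∀ {a b p q} → a ≡ b → p ≋ q → (a ∷ p) ≋ (b ∷ q)
  ∷-cong a≡b (mk≋ e) = mk≋ λ { zero → a≡b ; (suc k) → e k }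

  coeffwise : ∀ {p q} (f : ℤ → ℤ) → (∀ k → coeff p k ≡ f (coeff q k)) → ∀ {q′} →
              q ≋ q′ → ∀ {p′} → (∀ k → coeff p′ k ≡ f (coeff q′ k)) → p ≋ p′
  coeffwise f hp (mk≋ e) hp′ = mk≋ λ k → ≡.trans (hp k) (≡.trans (cong f (e k)) (≡.sym (hp′ k)))

+P-cong : ∀ {p p′ q q′} → p ≋ p′ → q ≋ q′ → p +P q ≋ p′ +P q′
+P-cong {p} {p′} {q} {q′} (mk≋ e) (mk≋ f) = mk≋ λ k →
  ≡.trans (coeff-+P p q k) (≡.trans (cong₂ ℤ._+_ (e k) (f k)) (≡.sym (coeff-+P p′ q′ k)))

-P-cong : ∀ {p p′} → p ≋ p′ → -P p ≋ -P p′
-P-cong {p} {p′} e = coeffwise ℤ.-_ (coeff--P p) e (coeff--P p′)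

+P-assoc : ∀ p q r → (p +P q) +P r ≋ p +P (q +P r)
+P-assoc p q r = mk≋ λ k → begin
  coeff ((p +P q) +P r) k                    ≡⟨ coeff-+P (p +P q) r k ⟩
  coeff (p +P q) k ℤ.+ coeff r k             ≡⟨ cong (ℤ._+ coeff r k) (coeff-+P p q k) ⟩
  (coeff p k ℤ.+ coeff q k) ℤ.+ coeff r k    ≡⟨ ℤ.+-assoc (coeff p k) _ _ ⟩
  coeff p k ℤ.+ (coeff q k ℤ.+ coeff r k)    ≡⟨ cong (λ x → coeff p k ℤ.+ x) (coeff-+P q r k) ⟨
  coeff p k ℤ.+ coeff (q +P r) k             ≡⟨ coeff-+P p (q +P r) k ⟨
  coeff (p +P (q +P r)) k                    ∎
  where open ≡.≡-Reasoning

+P-comm : ∀ p q → p +P q ≋ q +P p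
+P-comm p q = mk≋ λ k →
  ≡.trans (coeff-+P p q k) (≡.trans (ℤ.+-comm (coeff p k) _) (≡.sym (coeff-+P q p k)))

+P-identityʳ : ∀ p → p +P [] ≋ p
+P-identityʳ p = mk≋ λ k → ≡.trans (coeff-+P p [] k) (ℤ.+-identityʳ _)

-P-inverseˡ : ∀ p → (-P p) +P p ≋ []
-P-inverseˡ p = mk≋ λ k → ≡.trans (coeff-+P (-P p) p k)
  (≡.trans (cong (ℤ._+ coeff p k) (coeff--P p k)) (ℤ.+-inverseˡ (coeff p k)))

+P-isAbelianGroup : IsAbelianGroup _≋_ _+P_ [] -P_
+P-isAbelianGroup = record
  { isGroup = record
    { isMonoid = record
      { isSemigroup = record
        { isMagma = record { isEquivalence = ≋-isEquivalence ; ∙-cong = +P-cong }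
        ; assoc   = +P-assoc
        }
      ; identity = (λ _ → ≋.refl) , +P-identityʳ
      }
    ; inverse = -P-inverseˡ , λ p → ≋.trans (+P-comm p (-P p)) (-P-inverseˡ p)
    ; ⁻¹-cong = -P-cong
    }
  ; comm = +P-comm
  }

+P-abelianGroup : AbelianGroup 0ℓ 0ℓ
+P-abelianGroup = record { isAbelianGroup = +P-isAbelianGroup }

open CommSemigroupProperties (AbelianGroup.commutativeSemigroup +P-abelianGroup)
  using (interchange; x∙yz≈y∙xz)

·P-cong : ∀ a {q q′} → q ≋ q′ → a ·P q ≋ a ·P q′
·P-cong a {q} {q′} e = coeffwise (a ℤ.*_) (coeff-·P a q) e (coeff-·P a q′)

·P-distribʳ-+ : ∀ a b r → (a ℤ.+ b) ·P r ≋ a ·P r +P b ·P r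
·P-distribʳ-+ a b r = mk≋ λ k → ≡.trans (coeff-·P (a ℤ.+ b) r k)
  (≡.trans (ℤ.*-distribʳ-+ (coeff r k) a b)
  (≡.sym (≡.trans (coeff-+P (a ·P r) _ k) (cong₂ ℤ._+_ (coeff-·P a r k) (coeff-·P b r k)))))

·P-distribˡ-+P : ∀ a p q → a ·P (p +P q) ≋ a ·P p +P a ·P q
·P-distribˡ-+P a p q = mk≋ λ k → ≡.trans (coeff-·P a (p +P q) k)
  (≡.trans (cong (a ℤ.*_) (coeff-+P p q k))
  (≡.trans (ℤ.*-distribˡ-+ a _ _)
  (≡.sym (≡.trans (coeff-+P (a ·P p) _ k) (cong₂ ℤ._+_ (coeff-·P a p k) (coeff-·P a q k))))))

·P-assoc : ∀ a b r → (a ℤ.* b) ·P r ≋ a ·P (b ·P r)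
·P-assoc a b r = mk≋ λ k → ≡.trans (coeff-·P (a ℤ.* b) r k)
  (≡.trans (ℤ.*-assoc a b _)
  (≡.sym (≡.trans (coeff-·P a (b ·P r) k) (cong (a ℤ.*_) (coeff-·P b r k)))))

·P-*P : ∀ a q r → (a ·P q) *P r ≋ a ·P (q *P r)
·P-*P a []      r = ≋.refl
·P-*P a (b ∷ q) r = ≋.trans
  (+P-cong (·P-assoc a b r) (∷-cong (≡.sym (ℤ.*-zeroʳ a)) (·P-*P a q r)))
  (≋.sym (·P-distribˡ-+P a (b ·P r) _))

shift-*P : ∀ s r → (+ 0 ∷ s) *P r ≋ (+ 0 ∷ s *P r)
shift-*P s r = +P-cong {p′ = []} (mk≋ λ k → ≡.trans (coeff-·P (+ 0) r k) (ℤ.*-zeroˡ (coeff r k))) ≋.refl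

*P-zeroʳ : ∀ p → p *P [] ≋ []
*P-zeroʳ []      = ≋.refl
*P-zeroʳ (a ∷ p) = ≋.trans (∷-cong refl (*P-zeroʳ p)) (mk≋ λ { zero → refl ; (suc k) → refl })

*P-congˡ : ∀ p {q q′} → q ≋ q′ → p *P q ≋ p *P q′
*P-congˡ []      e = ≋.refl
*P-congˡ (a ∷ p) e = +P-cong (·P-cong a e) (∷-cong refl (*P-congˡ p e))

*P-∷ʳ : ∀ q a p → q *P (a ∷ p) ≋ a ·P q +P (+ 0 ∷ q *P p)
*P-∷ʳ []      a p = mk≋ λ { zero → refl ; (suc k) → refl }
*P-∷ʳ (b ∷ q) a p = ∷-cong (cong (ℤ._+ + 0) (ℤ.*-comm b a))
  (≋.trans (+P-cong ≋.refl (*P-∷ʳ q a p)) (x∙yz≈y∙xz (b ·P p) (a ·P q) _))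

*P-comm : ∀ p q → p *P q ≋ q *P p
*P-comm []      q = ≋.sym (*P-zeroʳ q)
*P-comm (a ∷ p) q = ≋.trans (+P-cong ≋.refl (∷-cong refl (*P-comm p q))) (≋.sym (*P-∷ʳ q a p))

*P-cong : ∀ {p p′ q q′} → p ≋ p′ → q ≋ q′ → p *P q ≋ p′ *P q′
*P-cong {p} {p′} {q} {q′} e f =
  ≋.trans (*P-congˡ p f) (≋.trans (*P-comm p q′) (≋.trans (*P-congˡ q′ e) (*P-comm q′ p′)))

*P-distribʳ : ∀ r p q → (p +P q) *P r ≋ (p *P r) +P (q *P r)
*P-distribʳ r []      q       = ≋.refl
*P-distribʳ r (a ∷ p) []      = ≋.sym (+P-identityʳ _)
*P-distribʳ r (a ∷ p) (b ∷ q) = ≋.trans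
  (+P-cong (·P-distribʳ-+ a b r) (∷-cong refl (*P-distribʳ r p q)))
  (interchange (a ·P r) (b ·P r) _ _)

*P-assoc : ∀ p q r → (p *P q) *P r ≋ p *P (q *P r)
*P-assoc []      q r = ≋.refl
*P-assoc (a ∷ p) q r = ≋.trans (*P-distribʳ r (a ·P q) _)
  (+P-cong (·P-*P a q r) (≋.trans (shift-*P (p *P q) r) (∷-cong refl (*P-assoc p q r))))

*P-identityˡ : ∀ p → constP (+ 1) *P p ≋ p
*P-identityˡ p = mk≋ λ k → ≡.trans (coeff-+P (+ 1 ·P p) _ k)
  (≡.trans (cong₂ ℤ._+_ (≡.trans (coeff-·P (+ 1) p k) (ℤ.*-identityˡ _)) (zero-tail k))
           (ℤ.+-identityʳ _))
  where
  zero-tail : ∀ k → coeff (+ 0 ∷ []) k ≡ + 0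
  zero-tail zero    = refl
  zero-tail (suc k) = refl

Poly-isCommutativeRing : IsCommutativeRing _≋_ _+P_ _*P_ -P_ [] (constP (+ 1))
Poly-isCommutativeRing = record
  { isRing = record
    { +-isAbelianGroup = +P-isAbelianGroup
    ; *-cong     = *P-cong
    ; *-assoc    = *P-assoc
    ; *-identity = *P-identityˡ , λ p → ≋.trans (*P-comm p _) (*P-identityˡ p)
    ; distrib    = (λ r p q → ≋.trans (*P-comm r _) (≋.trans (*P-distribʳ r p q)
                                 (+P-cong (*P-comm p r) (*P-comm q r))))
                 , *P-distribʳ
    }
  ; *-comm = *P-comm
  }

ℤ[λ] : CommutativeRing 0ℓ 0ℓ
ℤ[λ] = record { isCommutativeRing = Poly-isCommutativeRing }

open CommutativeRing ℤ[λ]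
  using (_≈_; 0#; 1#; setoid; semiring; ring; +-monoid; *-monoid; +-commutativeMonoid;
         +-cong; *-cong; -‿cong;
         +-identityˡ; +-identityʳ; -‿inverseʳ; *-identityˡ; *-identityʳ; zeroˡ; zeroʳ; *-comm; *-assoc)
  renaming (refl to ≈-refl; sym to ≈-sym; trans to ≈-trans; reflexive to ≈-reflexive)

-- Without a zero test the solver cannot prove identities whose normal
-- form is 0#.
0#≈? : ∀ p → Maybe (0# ≈ p)
0#≈? []           = just ≈-refl
0#≈? (+ 0 ∷ p)    = Maybe.map (λ (mk≋ 0≡p) → mk≋ λ { zero → refl ; (suc k) → 0≡p k }) (0#≈? p)
0#≈? (_ ∷ _)      = nothing

ℤ[λ]-ACR : ACR.AlmostCommutativeRing 0ℓ 0ℓ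
ℤ[λ]-ACR = ACR.fromCommutativeRing ℤ[λ] 0#≈?

+P-congˡ : ∀ x {y z} → y ≈ z → x +P y ≈ x +P z
+P-congˡ x = +-cong (≈-refl {x})

+P-congʳ : ∀ z {x y} → x ≈ y → x +P z ≈ y +P z
+P-congʳ z x≈y = +-cong x≈y (≈-refl {z})

*P-congʳ : ∀ z {x y} → x ≈ y → x *P z ≈ y *P z
*P-congʳ z x≈y = *-cong x≈y (≈-refl {z})

open import Algebra.Properties.Semiring.Sum semiring
open import Algebra.Properties.Monoid.Sum *-monoid using () renaming (sum to prod; sum-cong-≋ to prod-cong)
open import Algebra.Properties.Ring ring
  using (-‿distribˡ-*; -‿distribʳ-*; -‿involutive; -‿+-comm; -0#≈0#; x∙y⁻¹≈ε⇒x≈y)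
open import Algebra.Definitions.RawSemiring (Semiring.rawSemiring semiring) using (_^_)
open import Relation.Binary.Reasoning.Setoid setoid

constP-0 : constP (+ 0) ≈ 0#
constP-0 = mk≋ λ { zero → refl ; (suc k) → refl }

constP-* : ∀ a b → constP a *P constP b ≈ constP (a ℤ.* b)
constP-* a b = mk≋ λ { zero → ℤ.+-identityʳ _ ; (suc k) → refl }

coeff-constP-*P : ∀ a p k → coeff (constP a *P p) k ≡ a ℤ.* coeff p k
coeff-constP-*P a p k = ≡.trans (coeff-+P (a ·P p) (+ 0 ∷ []) k)
  (≡.trans (cong₂ ℤ._+_ (coeff-·P a p k) (coeff-≡ constP-0 k)) (ℤ.+-identityʳ _))

sumFin≡sum : ∀ {n} (f : Fin n → Poly) → sumFin f ≡ sum f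
sumFin≡sum {zero}  f = refl
sumFin≡sum {suc n} f = cong (f zero +P_) (sumFin≡sum (f ∘ suc))

-‿sum : ∀ {n} (f : Fin n → Poly) → -P sum f ≈ sum (λ i → -P f i)
-‿sum {zero}  f = ≈-refl
-‿sum {suc n} f = ≈-trans (≈-sym (-‿+-comm (f zero) _)) (+P-congˡ (-P f zero) (-‿sum (f ∘ suc)))

sum-linear : ∀ {n} α β (x y : Fin n → Poly) →
             sum (λ j → α *P x j +P β *P y j) ≈ α *P sum x +P β *P sum y
sum-linear α β x y = ≈-trans (∑-distrib-+ (λ j → α *P x j) (λ j → β *P y j))
  (+-cong (≈-sym (*-distribˡ-sum α x)) (≈-sym (*-distribˡ-sum β y)))

-- Determinants

-- Unlike constP (parity k), this does not unfold to a list for symbolic k,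
-- which would block unification with products having it as left factor.
infix 20 -1^_
-1^_ : ℕ → Poly
-1^ zero  = 1#
-1^ suc k = -P -1^ k

-1^-parity : ∀ k → constP (parity k) ≈ -1^ k
-1^-parity zero          = ≈-refl
-1^-parity (suc zero)    = mk≋ λ { zero → refl ; (suc k) → refl }
-1^-parity (suc (suc k)) = ≈-trans (-1^-parity k) (≈-sym (-‿involutive (-1^ k)))

det-suc : ∀ n (M : Mat (suc n)) →
          det (suc n) M ≈ sum (λ j → -1^ toℕ j *P M zero j *P det n (minor zero j M))
det-suc n M = ≈-trans (≈-reflexive (sumFin≡sum term)) (sum-cong-≋ λ j →
  *P-congʳ (det n (minor zero j M)) (*P-congʳ (M zero j) (-1^-parity (toℕ j))))
  where
  term : Fin (suc n) → Poly
  term j = constP (parity (toℕ j)) *P M zero j *P det n (minor zero j M)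

det-cong : ∀ n {M N : Mat n} → (∀ i j → M i j ≈ N i j) → det n M ≈ det n N
det-cong zero    M≈N = ≈-refl
det-cong (suc n) {M} {N} M≈N = begin
  det (suc n) M                                           ≈⟨ det-suc n M ⟩
  sum (λ j → -1^ toℕ j *P M zero j *P det n (minor zero j M)) ≈⟨ sum-cong-≋ (λ j →
    *-cong (*P-congˡ (-1^ toℕ j) (M≈N zero j)) (det-cong n λ a b → M≈N (suc a) (punchIn j b))) ⟩
  sum (λ j → -1^ toℕ j *P N zero j *P det n (minor zero j N)) ≈⟨ det-suc n N ⟨
  det (suc n) N                                           ∎

det-linearInRow : ∀ n (A B C : Mat n) r α β →
  (∀ i → i ≢ r → ∀ j → A i j ≈ C i j × B i j ≈ C i j) →
  (∀ j → C r j ≈ α *P A r j +P β *P B r j) →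
  det n C ≈ α *P det n A +P β *P det n B
det-linearInRow (suc n) A B C r α β off on = begin
  det (suc n) C                   ≈⟨ det-suc n C ⟩
  sum (λ j → -1^ toℕ j *P C zero j *P det n (minor zero j C)) ≈⟨ sum-cong-≋ (term r off on) ⟩
  sum (λ j → α *P expand A j +P β *P expand B j) ≈⟨ sum-linear α β (expand A) (expand B) ⟩
  α *P sum (expand A) +P β *P sum (expand B)     ≈⟨ +-cong (*P-congˡ α (det-suc n A)) (*P-congˡ β (det-suc n B)) ⟨
  α *P det (suc n) A +P β *P det (suc n) B        ∎
  where
  expand : Mat (suc n) → Fin (suc n) → Poly
  expand M j = -1^ toℕ j *P M zero j *P det n (minor zero j M)

  term : ∀ r → (∀ i → i ≢ r → ∀ j → A i j ≈ C i j × B i j ≈ C i j) →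
         (∀ j → C r j ≈ α *P A r j +P β *P B r j) →
         ∀ j → -1^ toℕ j *P C zero j *P det n (minor zero j C) ≈ α *P expand A j +P β *P expand B j
  term zero off on j = begin
    s *P C zero j *P det n (minor zero j C)
      ≈⟨ *-cong (*P-congˡ s (on j)) (det-cong n λ a b → ≈-sym (proj₁ (off (suc a) (λ ()) _))) ⟩
    s *P (α *P A zero j +P β *P B zero j) *P det n (minor zero j A)
      ≈⟨ distribute s (A zero j) (B zero j) (det n (minor zero j A)) α β ⟩
    α *P (s *P A zero j *P det n (minor zero j A)) +P β *P (s *P B zero j *P det n (minor zero j A))
      ≈⟨ +P-congˡ _ (*P-congˡ β (*P-congˡ (s *P B zero j) (det-cong n λ a b →
           ≈-trans (proj₁ (off (suc a) (λ ()) _)) (≈-sym (proj₂ (off (suc a) (λ ()) _)))))) ⟩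
    α *P expand A j +P β *P expand B j ∎
    where
    s : Poly
    s = -1^ toℕ j
    distribute : ∀ s a b d α β → s *P (α *P a +P β *P b) *P d ≈ α *P (s *P a *P d) +P β *P (s *P b *P d)
    distribute = solve-∀ ℤ[λ]-ACR
  term (suc r) off on j = begin
    s *P C zero j *P det n (minor zero j C)
      ≈⟨ *P-congˡ (s *P C zero j) (det-linearInRow n (minor zero j A) (minor zero j B) (minor zero j C) r α β
           (λ i i≢r _ → off (suc i) (i≢r ∘ Fin.suc-injective) _) (λ _ → on _)) ⟩
    s *P C zero j *P (α *P det n (minor zero j A) +P β *P det n (minor zero j B))
      ≈⟨ distribute s (C zero j) (det n (minor zero j A)) (det n (minor zero j B)) α β ⟩
    α *P (s *P C zero j *P det n (minor zero j A)) +P β *P (s *P C zero j *P det n (minor zero j B))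
      ≈⟨ +-cong (*P-congˡ α (*P-congʳ _ (*P-congˡ s (≈-sym (proj₁ (off zero (λ ()) j))))))
                (*P-congˡ β (*P-congʳ _ (*P-congˡ s (≈-sym (proj₂ (off zero (λ ()) j)))))) ⟩
    α *P expand A j +P β *P expand B j ∎
    where
    s : Poly
    s = -1^ toℕ j
    distribute : ∀ s c a b α β → s *P c *P (α *P a +P β *P b) ≈ α *P (s *P c *P a) +P β *P (s *P c *P b)
    distribute = solve-∀ ℤ[λ]-ACR

-1^-punchOut-flip : ∀ {m} (a b : Fin (suc m)) (a≢b : a ≢ b) (b≢a : b ≢ a) →
  -1^ toℕ a *P -1^ toℕ (punchOut a≢b) ≈ -P (-1^ toℕ b *P -1^ toℕ (punchOut b≢a))
-1^-punchOut-flip zero zero a≢b _ = ⊥-elim (a≢b refl)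
-1^-punchOut-flip {suc m} zero (suc b) _ _ = flip (-1^ toℕ b)
  where
  flip : ∀ x → 1# *P x ≈ -P ((-P x) *P 1#)
  flip = solve-∀ ℤ[λ]-ACR
-1^-punchOut-flip {suc m} (suc a) zero _ _ = flip (-1^ toℕ a)
  where
  flip : ∀ x → (-P x) *P 1# ≈ -P (1# *P x)
  flip = solve-∀ ℤ[λ]-ACR
-1^-punchOut-flip {suc m} (suc a) (suc b) a≢b b≢a = ≈-trans
  (negate² (-1^ toℕ a) (-1^ toℕ (punchOut (a≢b ∘ cong suc))))
  (≈-trans (-1^-punchOut-flip a b (a≢b ∘ cong suc) (b≢a ∘ cong suc))
           (-‿cong (≈-sym (negate² (-1^ toℕ b) (-1^ toℕ (punchOut (b≢a ∘ cong suc)))))))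
  where
  negate² : ∀ x y → (-P x) *P (-P y) ≈ x *P y
  negate² = solve-∀ ℤ[λ]-ACR

punchIn-punchIn-punchOut : ∀ {m} (a b : Fin (suc (suc m))) (a≢b : a ≢ b) (b≢a : b ≢ a) y →
  punchIn a (punchIn (punchOut a≢b) y) ≡ punchIn b (punchIn (punchOut b≢a) y)
punchIn-punchIn-punchOut zero    zero    a≢b _ y = ⊥-elim (a≢b refl)
punchIn-punchIn-punchOut zero    (suc b) _   _ y = refl
punchIn-punchIn-punchOut (suc a) zero    _   _ y = refl
punchIn-punchIn-punchOut {suc m} (suc a) (suc b) _ _ zero = refl
punchIn-punchIn-punchOut {suc m} (suc a) (suc b) a≢b b≢a (suc y) =
  cong suc (punchIn-punchIn-punchOut a b (a≢b ∘ cong suc) (b≢a ∘ cong suc) y)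

module _ {n} (M : Mat (suc (suc n))) where

  -- Terms of the expansion along the first two rows: row 0 uses column j,
  -- row 1 uses column k of the minor, i.e. column punchIn j k of M.
  expansionTerm₂ : Fin (suc (suc n)) → Fin (suc n) → Poly
  expansionTerm₂ j k = (-1^ toℕ j *P -1^ toℕ k) *P (M zero j *P M (suc zero) (punchIn j k))
                         *P det n (minor zero k (minor zero j M))

  pairTerm : Fin (suc (suc n)) → Fin (suc (suc n)) → Poly
  pairTerm a b with a Fin.≟ b
  ... | yes _   = 0#
  ... | no  a≢b = expansionTerm₂ a (punchOut a≢b)

  pairTerm-≢ : ∀ a b (a≢b : a ≢ b) → pairTerm a b ≡ expansionTerm₂ a (punchOut a≢b)
  pairTerm-≢ a b a≢b with a Fin.≟ b
  ... | yes a≡b  = ⊥-elim (a≢b a≡b)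
  ... | no  a≢b′ = cong (expansionTerm₂ a) (Fin.punchOut-cong a refl)

  pairTerm-punchIn : ∀ j k → pairTerm j (punchIn j k) ≡ expansionTerm₂ j k
  pairTerm-punchIn j k = ≡.trans (pairTerm-≢ j (punchIn j k) (Fin.punchInᵢ≢i j k ∘ ≡.sym))
                                 (cong (expansionTerm₂ j) (Fin.punchOut-punchIn j))

  det-expand₂ : det (suc (suc n)) M ≈ sum (λ j → sum (λ k → pairTerm j (punchIn j k)))
  det-expand₂ = ≈-trans (det-suc (suc n) M) (sum-cong-≋ λ j → begin
    -1^ toℕ j *P M zero j *P det (suc n) (minor zero j M)
      ≈⟨ *P-congˡ (-1^ toℕ j *P M zero j) (det-suc n (minor zero j M)) ⟩
    -1^ toℕ j *P M zero j *P sum (λ k → -1^ toℕ k *P M (suc zero) (punchIn j k) *P D j k)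
      ≈⟨ *-distribˡ-sum (-1^ toℕ j *P M zero j) (λ k → -1^ toℕ k *P M (suc zero) (punchIn j k) *P D j k) ⟩
    sum (λ k → -1^ toℕ j *P M zero j *P (-1^ toℕ k *P M (suc zero) (punchIn j k) *P D j k))
      ≈⟨ sum-cong-≋ (λ k → ≈-trans (regroup (-1^ toℕ j) (M zero j) (-1^ toℕ k) _ (D j k))
                                    (≈-reflexive (≡.sym (pairTerm-punchIn j k)))) ⟩
    sum (λ k → pairTerm j (punchIn j k)) ∎)
    where
    D : Fin (suc (suc n)) → Fin (suc n) → Poly
    D j k = det n (minor zero k (minor zero j M))
    regroup : ∀ s a t b d → s *P a *P (t *P b *P d) ≈ (s *P t) *P (a *P b) *P d
    regroup = solve-∀ ℤ[λ]-ACR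

-- In the expansion along the first two rows, the term of N using columns
-- (a , b) is minus the term of M using columns (b , a).
det-swap₀₁ : ∀ n (M N : Mat (suc (suc n))) →
  (∀ j → N zero j ≈ M (suc zero) j) → (∀ j → N (suc zero) j ≈ M zero j) →
  (∀ i j → N (suc (suc i)) j ≈ M (suc (suc i)) j) →
  det (suc (suc n)) N ≈ -P det (suc (suc n)) M
det-swap₀₁ n M N row₀ row₁ rest = begin
  det (suc (suc n)) N
    ≈⟨ det-expand₂ N ⟩
  sum (λ j → sum (λ k → pairTerm N j (punchIn j k)))
    ≈⟨ sum-cong-≋ (λ j → sum-cong-≋ λ k → pairTerm-swap j (punchIn j k)) ⟩
  sum (λ j → sum (λ k → -P pairTerm M (punchIn j k) j))
    ≈⟨ ≈-trans (sum-cong-≋ λ j → ≈-sym (-‿sum λ k → pairTerm M (punchIn j k) j))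
               (≈-sym (-‿sum λ j → sum λ k → pairTerm M (punchIn j k) j)) ⟩
  -P sum (λ j → sum (λ k → pairTerm M (punchIn j k) j))
    ≈⟨ -‿cong (sum-offDiagonal-transpose +-commutativeMonoid (pairTerm M)) ⟨
  -P sum (λ j → sum (λ k → pairTerm M j (punchIn j k)))
    ≈⟨ -‿cong (det-expand₂ M) ⟨
  -P det (suc (suc n)) M ∎
  where
  pairTerm-swap : ∀ a b → pairTerm N a b ≈ -P pairTerm M b a
  pairTerm-swap a b with a Fin.≟ b | b Fin.≟ a
  ... | yes _   | yes _   = mk≋ λ _ → refl
  ... | yes a≡b | no  b≢a = ⊥-elim (b≢a (≡.sym a≡b))
  ... | no  a≢b | yes b≡a = ⊥-elim (a≢b (≡.sym b≡a))
  ... | no  a≢b | no  b≢a = begin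
    (sa *P -1^ toℕ (punchOut a≢b)) *P (N zero a *P N (suc zero) (punchIn a (punchOut a≢b))) *P minorN
      ≈⟨ *-cong (*-cong (-1^-punchOut-flip a b a≢b b≢a) (*-cong (row₀ a) (≈-trans (row₁ _)
           (≈-reflexive (cong (M zero) (Fin.punchIn-punchOut a≢b)))))) minors ⟩
    (-P s) *P (M (suc zero) a *P M zero b) *P minorM
      ≈⟨ flip s (M (suc zero) a) (M zero b) minorM ⟩
    -P (s *P (M zero b *P M (suc zero) a) *P minorM)
      ≈⟨ -‿cong (*P-congʳ minorM (*P-congˡ s (*P-congˡ (M zero b)
           (≈-reflexive (cong (M (suc zero)) (≡.sym (Fin.punchIn-punchOut b≢a))))))) ⟩
    -P expansionTerm₂ M b (punchOut b≢a) ∎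
    where
    sa s minorN minorM : Poly
    sa = -1^ toℕ a
    s = -1^ toℕ b *P -1^ toℕ (punchOut b≢a)
    minorN = det n (minor zero (punchOut a≢b) (minor zero a N))
    minorM = det n (minor zero (punchOut b≢a) (minor zero b M))
    minors : minorN ≈ minorM
    minors = det-cong n λ x y → ≈-trans (rest x _)
      (≈-reflexive (cong (M (suc (suc x))) (punchIn-punchIn-punchOut a b a≢b b≢a y)))
    flip : ∀ s u v d → (-P s) *P (u *P v) *P d ≈ -P (s *P (v *P u) *P d)
    flip = solve-∀ ℤ[λ]-ACR

swapAdjacent : ∀ {n} → Fin (suc n) → Fin (suc (suc n)) → Fin (suc (suc n))
swapAdjacent         zero    zero          = suc zero
swapAdjacent         zero    (suc zero)    = zero
swapAdjacent         zero    (suc (suc a)) = suc (suc a)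
swapAdjacent {suc n} (suc i) zero          = zero
swapAdjacent {suc n} (suc i) (suc a)       = suc (swapAdjacent i a)

swapAdjacent-inject₁ : ∀ {n} (i : Fin (suc n)) → swapAdjacent i (inject₁ i) ≡ suc i
swapAdjacent-inject₁ zero            = refl
swapAdjacent-inject₁ {suc n} (suc i) = cong suc (swapAdjacent-inject₁ i)

swapAdjacent-punchIn : ∀ {n} (i : Fin (suc n)) a →
                       swapAdjacent i (punchIn (inject₁ i) a) ≡ punchIn (suc i) a
swapAdjacent-punchIn zero            zero    = refl
swapAdjacent-punchIn zero            (suc a) = refl
swapAdjacent-punchIn {suc n} (suc i) zero    = refl
swapAdjacent-punchIn {suc n} (suc i) (suc a) = cong suc (swapAdjacent-punchIn i a)

det-swapAdjacent : ∀ n (i : Fin (suc n)) (M : Mat (suc (suc n))) →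
                   det (suc (suc n)) (M ∘ swapAdjacent i) ≈ -P det (suc (suc n)) M
det-swapAdjacent n zero M = det-swap₀₁ n M (M ∘ swapAdjacent zero)
  (λ _ → ≈-refl) (λ _ → ≈-refl) (λ i j → ≈-reflexive (cong (λ r → M r j) (fixes i)))
  where
  fixes : ∀ {n} (i : Fin n) → swapAdjacent zero (suc (suc i)) ≡ suc (suc i)
  fixes {suc n} i = refl
det-swapAdjacent (suc n) (suc i) M = begin
  det (suc (suc (suc n))) (M ∘ swapAdjacent (suc i))
    ≈⟨ det-suc (suc (suc n)) (M ∘ swapAdjacent (suc i)) ⟩
  sum (λ j → -1^ toℕ j *P M zero j *P det (suc (suc n)) (minor zero j M ∘ swapAdjacent i))
    ≈⟨ sum-cong-≋ (λ j → *P-congˡ (-1^ toℕ j *P M zero j) (det-swapAdjacent n i (minor zero j M))) ⟩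
  sum (λ j → -1^ toℕ j *P M zero j *P -P det (suc (suc n)) (minor zero j M))
    ≈⟨ sum-cong-≋ (λ j → ≈-sym (-‿distribʳ-* (-1^ toℕ j *P M zero j) (det (suc (suc n)) (minor zero j M)))) ⟩
  sum (λ j → -P (-1^ toℕ j *P M zero j *P det (suc (suc n)) (minor zero j M)))
    ≈⟨ -‿sum (λ j → -1^ toℕ j *P M zero j *P det (suc (suc n)) (minor zero j M)) ⟨
  -P sum (λ j → -1^ toℕ j *P M zero j *P det (suc (suc n)) (minor zero j M))
    ≈⟨ -‿cong (det-suc (suc (suc n)) M) ⟨
  -P det (suc (suc (suc n))) M ∎

rowExpansion : ∀ n → Mat (suc n) → Fin (suc n) → Poly
rowExpansion n M u = sum (λ w → -1^ (toℕ u ℕ.+ toℕ w) *P M u w *P det n (minor u w M))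

det-rowExpansion : ∀ n (M : Mat (suc n)) u → det (suc n) M ≈ rowExpansion n M u
det-rowExpansion n M u = go (toℕ u) n M u refl
  where
  -- Induction on toℕ u: an adjacent swap moves row suc u to row inject₁ u.
  go : ∀ k n (M : Mat (suc n)) u → toℕ u ≡ k → det (suc n) M ≈ rowExpansion n M u
  go k       n       M zero    _  = det-suc n M
  go (suc k) (suc n) M (suc u) eq = begin
    det (suc (suc n)) M
      ≈⟨ -‿involutive _ ⟨
    -P -P det (suc (suc n)) M
      ≈⟨ -‿cong (det-swapAdjacent n u M) ⟨
    -P det (suc (suc n)) M′
      ≈⟨ -‿cong (go k (suc n) M′ (inject₁ u) (≡.trans (Fin.toℕ-inject₁ u) (ℕ.suc-injective eq))) ⟩
    -P rowExpansion (suc n) M′ (inject₁ u)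
      ≈⟨ -‿sum (λ w → -1^ (toℕ (inject₁ u) ℕ.+ toℕ w) *P M′ (inject₁ u) w
                         *P det (suc n) (minor (inject₁ u) w M′)) ⟩
    sum (λ w → -P (-1^ (toℕ (inject₁ u) ℕ.+ toℕ w) *P M′ (inject₁ u) w
                    *P det (suc n) (minor (inject₁ u) w M′)))
      ≈⟨ sum-cong-≋ term ⟩
    rowExpansion (suc n) M (suc u) ∎
    where
    M′ : Mat (suc (suc n))
    M′ = M ∘ swapAdjacent u
    term : ∀ w → -P (-1^ (toℕ (inject₁ u) ℕ.+ toℕ w) *P M′ (inject₁ u) w
                      *P det (suc n) (minor (inject₁ u) w M′))
                 ≈ -1^ (toℕ (suc u) ℕ.+ toℕ w) *P M (suc u) w *P det (suc n) (minor (suc u) w M)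
    term w rewrite Fin.toℕ-inject₁ u | swapAdjacent-inject₁ u = ≈-trans
      (-‿distribˡ-* (-1^ (toℕ u ℕ.+ toℕ w) *P M (suc u) w) _)
      (*-cong (-‿distribˡ-* (-1^ (toℕ u ℕ.+ toℕ w)) (M (suc u) w))
              (det-cong (suc n) λ a b → ≈-reflexive
                (cong (λ r → M r (punchIn w b)) (swapAdjacent-punchIn u a))))

x≈-x⇒x≈0 : ∀ x → x ≈ -P x → x ≈ 0#
x≈-x⇒x≈0 x (mk≋ x≡-x) = mk≋ λ k → c≡-c⇒c≡0 (≡.trans (x≡-x k) (coeff--P x k))
  where
  c≡-c⇒c≡0 : ∀ {c} → c ≡ ℤ.- c → c ≡ + 0
  c≡-c⇒c≡0 {+ zero}   _  = refl
  c≡-c⇒c≡0 {+ suc _}  ()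
  c≡-c⇒c≡0 { -[1+ _ ]} ()

private
  det-equalRows-suc : ∀ n →
    (∀ (M : Mat n) i j → i ≢ j → (∀ b → M i b ≈ M j b) → det n M ≈ 0#) →
    ∀ (M : Mat (suc n)) i j → i ≢ j → (∀ b → M (suc i) b ≈ M (suc j) b) → det (suc n) M ≈ 0#
  det-equalRows-suc n equalRows M i j i≢j same = begin
    det (suc n) M
      ≈⟨ det-suc n M ⟩
    sum (λ k → -1^ toℕ k *P M zero k *P det n (minor zero k M))
      ≈⟨ sum-cong-≋ (λ k → ≈-trans (*P-congˡ (-1^ toℕ k *P M zero k)
           (equalRows (minor zero k M) i j i≢j (λ b → same (punchIn k b))))
           (zeroʳ (-1^ toℕ k *P M zero k))) ⟩
    sum {suc n} (λ _ → 0#)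
      ≈⟨ sum-replicate-zero (suc n) ⟩
    0# ∎

  det-equalRows₀ : ∀ n →
    (∀ (M : Mat n) i j → i ≢ j → (∀ b → M i b ≈ M j b) → det n M ≈ 0#) →
    ∀ (M : Mat (suc n)) j → (∀ b → M zero b ≈ M (suc j) b) → det (suc n) M ≈ 0#
  det-equalRows₀ (suc n) _ M zero same = x≈-x⇒x≈0 (det (suc (suc n)) M)
    (det-swap₀₁ n M M same (λ b → ≈-sym (same b)) (λ _ _ → ≈-refl))
  det-equalRows₀ (suc (suc n)) equalRows M (suc j) same = begin
    det (suc (suc (suc n))) M                          ≈⟨ -‿involutive _ ⟨
    -P -P det (suc (suc (suc n))) M                    ≈⟨ -‿cong (det-swapAdjacent (suc n) zero M) ⟨
    -P det (suc (suc (suc n))) (M ∘ swapAdjacent zero) ≈⟨ -‿cong (det-equalRows-suc (suc (suc n)) equalRows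
                                                            (M ∘ swapAdjacent zero) zero (suc j) (λ ()) same) ⟩
    -P 0#                                              ≈⟨ -0#≈0# ⟩
    0#                                                 ∎

det-equalRows : ∀ n (M : Mat n) i j → i ≢ j → (∀ b → M i b ≈ M j b) → det n M ≈ 0#
det-equalRows (suc n) M zero    zero    i≢j _    = ⊥-elim (i≢j refl)
det-equalRows (suc n) M zero    (suc j) _   same = det-equalRows₀ n (det-equalRows n) M j same
det-equalRows (suc n) M (suc i) zero    _   same =
  det-equalRows₀ n (det-equalRows n) M i (λ b → ≈-sym (same b))
det-equalRows (suc n) M (suc i) (suc j) i≢j same =
  det-equalRows-suc n (det-equalRows n) M i j (i≢j ∘ cong suc) same

det-addRowCombination : ∀ n (M C : Mat n) r {T} (d : Fin T → Poly) (g : Fin T → Fin n) →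
  (∀ z → g z ≢ r) → (∀ i → i ≢ r → ∀ j → C i j ≈ M i j) →
  (∀ j → C r j ≈ M r j +P sum (λ z → d z *P M (g z) j)) →
  det n C ≈ det n M
det-addRowCombination n M C r {zero} d g _ off on = det-cong n λ i j → case i
  where
  case : ∀ i {j} → C i j ≈ M i j
  case i {j} with i Fin.≟ r
  ... | yes refl = ≈-trans (on j) (+-identityʳ (M r j))
  ... | no  i≢r  = off i i≢r j
det-addRowCombination n M C r {suc T} d g g≢r off on = begin
  det n C                              ≈⟨ det-linearInRow n C′ B C r 1# (d zero) off′ on′ ⟩
  1# *P det n C′ +P d zero *P det n B  ≈⟨ +-cong (*P-congˡ 1# IH) (*P-congˡ (d zero) detB≈0) ⟩
  1# *P det n M +P d zero *P 0#         ≈⟨ cleanup (det n M) (d zero) ⟩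
  det n M                              ∎
  where
  C′ B : Mat n
  C′ = updateAt M r (const λ j → M r j +P sum (λ z → d (suc z) *P M (g (suc z)) j))
  B  = updateAt M r (const (M (g zero)))

  off′ : ∀ i → i ≢ r → ∀ j → C′ i j ≈ C i j × B i j ≈ C i j
  off′ i i≢r j = ≈-trans (≈-reflexive (cong (λ row → row j) (updateAt-minimal i r M i≢r))) (≈-sym (off i i≢r j))
               , ≈-trans (≈-reflexive (cong (λ row → row j) (updateAt-minimal i r M i≢r))) (≈-sym (off i i≢r j))

  on′ : ∀ j → C r j ≈ 1# *P C′ r j +P d zero *P B r j
  on′ j = begin
    C r j
      ≈⟨ on j ⟩
    M r j +P (d zero *P M (g zero) j +P sum (λ z → d (suc z) *P M (g (suc z)) j))
      ≈⟨ regroup (M r j) (d zero *P M (g zero) j) (sum (λ z → d (suc z) *P M (g (suc z)) j)) ⟩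
    1# *P (M r j +P sum (λ z → d (suc z) *P M (g (suc z)) j)) +P d zero *P M (g zero) j
      ≈⟨ ≈-reflexive (≡.cong₂ (λ x y → 1# *P x j +P d zero *P y j)
                         (≡.sym (updateAt-updates r M)) (≡.sym (updateAt-updates r M))) ⟩
    1# *P C′ r j +P d zero *P B r j ∎
    where
    regroup : ∀ m a s → m +P (a +P s) ≈ 1# *P (m +P s) +P a
    regroup = solve-∀ ℤ[λ]-ACR

  IH : det n C′ ≈ det n M
  IH = det-addRowCombination n M C′ r (d ∘ suc) (g ∘ suc) (g≢r ∘ suc)
         (λ i i≢r j → ≈-reflexive (cong (λ row → row j) (updateAt-minimal i r M i≢r)))
         (λ j → ≈-reflexive (cong (λ row → row j) (updateAt-updates r M)))

  detB≈0 : det n B ≈ 0#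
  detB≈0 = det-equalRows n B r (g zero) (g≢r zero ∘ ≡.sym) λ b → ≈-reflexive (≡.trans
    (cong (λ row → row b) (updateAt-updates r M))
    (cong (λ row → row b) (≡.sym (updateAt-minimal (g zero) r M (g≢r zero)))))

  cleanup : ∀ x y → 1# *P x +P y *P 0# ≈ x
  cleanup x y = ≈-trans (+-cong (*-identityˡ x) (zeroʳ y)) (+-identityʳ x)

det-addRowCombinations : ∀ N {n T} (M C : Mat N) (g : Fin n → Fin N) (h : Fin T → Fin N)
  (d : Fin n → Fin T → Poly) → (∀ l l′ → g l ≡ g l′ → l ≡ l′) → (∀ l z → h z ≢ g l) →
  (∀ i → (∀ l → i ≢ g l) → ∀ j → C i j ≈ M i j) →
  (∀ l j → C (g l) j ≈ M (g l) j +P sum (λ z → d l z *P M (h z) j)) →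
  det N C ≈ det N M
det-addRowCombinations N {zero} M C g h d _ _ off _ = det-cong N λ i → off i λ ()
det-addRowCombinations N {suc n} M C g h d g-inj h≢g off on = ≈-trans
  (det-addRowCombination N C₁ C (g zero) (d zero) h (λ z → h≢g zero z) off₀ on₀)
  (det-addRowCombinations N M C₁ (g ∘ suc) h (d ∘ suc) (λ l l′ → Fin.suc-injective ∘ g-inj (suc l) (suc l′))
    (λ l → h≢g (suc l)) off₁ on₁)
  where
  C₁ : Mat N
  C₁ = updateAt C (g zero) (const (M (g zero)))

  C₁-≢ : ∀ i → i ≢ g zero → ∀ j → C₁ i j ≡ C i j
  C₁-≢ i i≢g₀ j = cong (λ row → row j) (updateAt-minimal i (g zero) C i≢g₀)

  C₁-≡ : ∀ j → C₁ (g zero) j ≡ M (g zero) j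
  C₁-≡ j = cong (λ row → row j) (updateAt-updates (g zero) C)

  off₀ : ∀ i → i ≢ g zero → ∀ j → C i j ≈ C₁ i j
  off₀ i i≢g₀ j = ≈-reflexive (≡.sym (C₁-≢ i i≢g₀ j))

  on₀ : ∀ j → C (g zero) j ≈ C₁ (g zero) j +P sum (λ z → d zero z *P C₁ (h z) j)
  on₀ j = ≈-trans (on zero j) (+-cong (≈-reflexive (≡.sym (C₁-≡ j))) (sum-cong-≋ λ z →
    *P-congˡ (d zero z) (≈-sym (≈-trans (≈-reflexive (C₁-≢ (h z) (h≢g zero z) j))
                                        (off (h z) (λ l → h≢g l z) j)))))

  off₁ : ∀ i → (∀ l → i ≢ g (suc l)) → ∀ j → C₁ i j ≈ M i j
  off₁ i i∉g j with i Fin.≟ g zero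
  ... | yes refl  = ≈-reflexive (C₁-≡ j)
  ... | no  i≢g₀  = ≈-trans (≈-reflexive (C₁-≢ i i≢g₀ j))
                            (off i (λ { zero → i≢g₀ ; (suc l) → i∉g l }) j)

  on₁ : ∀ l j → C₁ (g (suc l)) j ≈ M (g (suc l)) j +P sum (λ z → d (suc l) z *P M (h z) j)
  on₁ l j = ≈-trans (≈-reflexive (C₁-≢ (g (suc l)) (λ eq → Fin.0≢1+n (≡.sym (g-inj (suc l) zero eq))) j))
                    (on (suc l) j)

det-scaleRows : ∀ n (s : Fin n → Poly) (M : Mat n) → det n (λ i j → s i *P M i j) ≈ prod s *P det n M
det-scaleRows zero    s M = ≈-sym (*-identityˡ 1#)
det-scaleRows (suc n) s M = begin
  det (suc n) (λ i j → s i *P M i j)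
    ≈⟨ det-suc n (λ i j → s i *P M i j) ⟩
  sum (λ j → -1^ toℕ j *P (s zero *P M zero j) *P det n (λ a b → s (suc a) *P minor zero j M a b))
    ≈⟨ sum-cong-≋ (λ j → ≈-trans
         (*P-congˡ (-1^ toℕ j *P (s zero *P M zero j)) (det-scaleRows n (s ∘ suc) (minor zero j M)))
         (regroup (-1^ toℕ j) (s zero) (M zero j) (prod (s ∘ suc)) (det n (minor zero j M)))) ⟩
  sum (λ j → prod s *P (-1^ toℕ j *P M zero j *P det n (minor zero j M)))
    ≈⟨ *-distribˡ-sum (prod s) (λ j → -1^ toℕ j *P M zero j *P det n (minor zero j M)) ⟨
  prod s *P sum (λ j → -1^ toℕ j *P M zero j *P det n (minor zero j M))
    ≈⟨ *P-congˡ (prod s) (det-suc n M) ⟨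
  prod s *P det (suc n) M ∎
  where
  regroup : ∀ σ s m p d → σ *P (s *P m) *P (p *P d) ≈ (s *P p) *P (σ *P m *P d)
  regroup = solve-∀ ℤ[λ]-ACR

det-blockLowerTriangular : ∀ n T (M : Mat (n ℕ.+ T)) → (∀ i t → M (i ↑ˡ T) (n ↑ʳ t) ≈ 0#) →
  det (n ℕ.+ T) M ≈ det n (λ i j → M (i ↑ˡ T) (j ↑ˡ T)) *P det T (λ s t → M (n ↑ʳ s) (n ↑ʳ t))
det-blockLowerTriangular zero    T M _      = ≈-sym (*-identityˡ (det T M))
det-blockLowerTriangular (suc n) T M upper0 = begin
  det (suc n ℕ.+ T) M
    ≈⟨ det-suc (n ℕ.+ T) M ⟩
  sum term
    ≈⟨ sum-↑-split +-monoid (suc n) T term ⟩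
  sum (λ i → term (i ↑ˡ T)) +P sum (λ t → term (suc n ↑ʳ t))
    ≈⟨ +-cong (sum-cong-≋ left) (sum-ε +-monoid (λ t → term (suc n ↑ʳ t)) right) ⟩
  sum (λ i → (-1^ toℕ i *P A zero i *P det n (minor zero i A)) *P det T D) +P 0#
    ≈⟨ +-identityʳ (sum (λ i → (-1^ toℕ i *P A zero i *P det n (minor zero i A)) *P det T D)) ⟩
  sum (λ i → (-1^ toℕ i *P A zero i *P det n (minor zero i A)) *P det T D)
    ≈⟨ *-distribʳ-sum (det T D) (λ i → -1^ toℕ i *P A zero i *P det n (minor zero i A)) ⟨
  sum (λ i → -1^ toℕ i *P A zero i *P det n (minor zero i A)) *P det T D
    ≈⟨ *P-congʳ (det T D) (det-suc n A) ⟨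
  det (suc n) A *P det T D ∎
  where
  A : Mat (suc n)
  A i j = M (i ↑ˡ T) (j ↑ˡ T)
  D : Mat T
  D s t = M (suc n ↑ʳ s) (suc n ↑ʳ t)
  term : Fin (suc n ℕ.+ T) → Poly
  term j = -1^ toℕ j *P M zero j *P det (n ℕ.+ T) (minor zero j M)

  right : ∀ t → term (suc n ↑ʳ t) ≈ 0#
  right t = ≈-trans (*P-congʳ (det (n ℕ.+ T) (minor zero (suc n ↑ʳ t) M))
                      (≈-trans (*P-congˡ (-1^ toℕ (suc n ↑ʳ t)) (upper0 zero t)) (zeroʳ (-1^ toℕ (suc n ↑ʳ t)))))
                    (zeroˡ (det (n ℕ.+ T) (minor zero (suc n ↑ʳ t) M)))

  punchIn-↑ˡ : ∀ {n} (i : Fin (suc n)) b → punchIn (i ↑ˡ T) (b ↑ˡ T) ≡ punchIn i b ↑ˡ T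
  punchIn-↑ˡ zero    b       = refl
  punchIn-↑ˡ (suc i) zero    = refl
  punchIn-↑ˡ (suc i) (suc b) = cong suc (punchIn-↑ˡ i b)

  punchIn-↑ʳ : ∀ {n} (i : Fin (suc n)) t → punchIn (i ↑ˡ T) (n ↑ʳ t) ≡ suc n ↑ʳ t
  punchIn-↑ʳ zero            t = refl
  punchIn-↑ʳ {suc n} (suc i) t = cong suc (punchIn-↑ʳ i t)

  left : ∀ i → term (i ↑ˡ T) ≈ (-1^ toℕ i *P A zero i *P det n (minor zero i A)) *P det T D
  left i = begin
    -1^ toℕ (i ↑ˡ T) *P M zero (i ↑ˡ T) *P det (n ℕ.+ T) (minor zero (i ↑ˡ T) M)
      ≈⟨ *P-congʳ (det (n ℕ.+ T) (minor zero (i ↑ˡ T) M))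
           (*P-congʳ (A zero i) (≈-reflexive (cong -1^_ (Fin.toℕ-↑ˡ i T)))) ⟩
    -1^ toℕ i *P A zero i *P det (n ℕ.+ T) (minor zero (i ↑ˡ T) M)
      ≈⟨ *P-congˡ (-1^ toℕ i *P A zero i) (det-blockLowerTriangular n T (minor zero (i ↑ˡ T) M)
           λ a t → ≈-trans (≈-reflexive (cong (M (suc a ↑ˡ T)) (punchIn-↑ʳ i t))) (upper0 (suc a) t)) ⟩
    -1^ toℕ i *P A zero i *P (det n (λ a b → M (suc a ↑ˡ T) (punchIn (i ↑ˡ T) (b ↑ˡ T)))
                           *P det T (λ s t → M (suc (n ↑ʳ s)) (punchIn (i ↑ˡ T) (n ↑ʳ t))))
      ≈⟨ *P-congˡ (-1^ toℕ i *P A zero i) (*-cong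
           (det-cong n λ a b → ≈-reflexive (cong (M (suc a ↑ˡ T)) (punchIn-↑ˡ i b)))
           (det-cong T λ s t → ≈-reflexive (cong (M (suc (n ↑ʳ s))) (punchIn-↑ʳ i t)))) ⟩
    -1^ toℕ i *P A zero i *P (det n (minor zero i A) *P det T D)
      ≈⟨ *-assoc (-1^ toℕ i *P A zero i) (det n (minor zero i A)) (det T D) ⟨
    (-1^ toℕ i *P A zero i *P det n (minor zero i A)) *P det T D ∎

δ : ∀ {n} → Fin n → Fin n → ℤ
δ i j with i Fin.≟ j
... | yes _ = + 1
... | no  _ = + 0

δ-refl : ∀ {n} (i : Fin n) → δ i i ≡ + 1
δ-refl i with i Fin.≟ i
... | yes _   = refl
... | no  i≢i = ⊥-elim (i≢i refl)

δ-≢ : ∀ {n} {i j : Fin n} → i ≢ j → δ i j ≡ + 0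
δ-≢ {i = i} {j} i≢j with i Fin.≟ j
... | yes i≡j = ⊥-elim (i≢j i≡j)
... | no  _   = refl

det-identity : ∀ n (M : Mat n) → (∀ i j → M i j ≈ constP (δ i j)) → det n M ≈ 1#
det-identity zero    M M≈I = ≈-refl
det-identity (suc n) M M≈I = begin
  det (suc n) M
    ≈⟨ det-suc n M ⟩
  sum (λ j → -1^ toℕ j *P M zero j *P det n (minor zero j M))
    ≈⟨ sum-single +-monoid (λ j → -1^ toℕ j *P M zero j *P det n (minor zero j M)) zero off ⟩
  1# *P M zero zero *P det n (minor zero zero M)
    ≈⟨ *-cong (*P-congˡ 1# (≈-trans (M≈I zero zero) (≈-reflexive (cong constP (δ-refl {suc n} zero)))))
              (det-identity n (minor zero zero M) λ i j → ≈-trans (M≈I (suc i) (suc j))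
                 (≈-reflexive (cong constP (δ-suc i j)))) ⟩
  1# *P 1# *P 1#
    ≈⟨ ≈-trans (*-identityʳ (1# *P 1#)) (*-identityˡ 1#) ⟩
  1# ∎
  where
  δ-suc : ∀ i j → δ {suc n} (suc i) (suc j) ≡ δ i j
  δ-suc i j with i Fin.≟ j
  ... | yes _ = refl
  ... | no  _ = refl
  off : ∀ j → j ≢ zero → -1^ toℕ j *P M zero j *P det n (minor zero j M) ≈ 0#
  off j j≢0 = ≈-trans (*P-congʳ (det n (minor zero j M)) (≈-trans (*P-congˡ (-1^ toℕ j)
    (≈-trans (M≈I zero j) (≈-trans (≈-reflexive (cong constP (δ-≢ (j≢0 ∘ ≡.sym)))) constP-0)))
    (zeroʳ (-1^ toℕ j)))) (zeroˡ (det n (minor zero j M)))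

sum-*-adjugate : ∀ m (D : Mat (suc m)) v u →
  sum (λ w → D v w *P adjugate (suc m) D w u) ≈ det (suc m) (updateAt D u (const (D v)))
sum-*-adjugate m D v u = ≈-sym (begin
  det (suc m) D′                ≈⟨ det-rowExpansion m D′ u ⟩
  rowExpansion m D′ u           ≈⟨ sum-cong-≋ term ⟩
  sum (λ w → D v w *P adjugate (suc m) D w u) ∎)
  where
  D′ : Mat (suc m)
  D′ = updateAt D u (const (D v))
  term : ∀ w → -1^ (toℕ u ℕ.+ toℕ w) *P D′ u w *P det m (minor u w D′) ≈ D v w *P adjugate (suc m) D w u
  term w = begin
    -1^ (toℕ u ℕ.+ toℕ w) *P D′ u w *P det m (minor u w D′)
      ≈⟨ *-cong (*-cong (≈-trans (≈-reflexive (cong -1^_ (ℕ.+-comm (toℕ u) (toℕ w))))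
                                 (≈-sym (-1^-parity (toℕ w ℕ.+ toℕ u))))
                        (≈-reflexive (cong (λ row → row w) (updateAt-updates u D))))
                (det-cong m λ a b → ≈-reflexive (cong (λ row → row (punchIn w b))
                  (updateAt-minimal (punchIn u a) u D (Fin.punchInᵢ≢i u a)))) ⟩
    constP (parity (toℕ w ℕ.+ toℕ u)) *P D v w *P det m (minor u w D)
      ≈⟨ swap (constP (parity (toℕ w ℕ.+ toℕ u))) (D v w) (det m (minor u w D)) ⟩
    D v w *P adjugate (suc m) D w u ∎
    where
    swap : ∀ a b c → a *P b *P c ≈ b *P (a *P c)
    swap = solve-∀ ℤ[λ]-ACR

sum-*-adjugate-≡ : ∀ m (D : Mat m) u → sum (λ w → D u w *P adjugate m D w u) ≈ det m D
sum-*-adjugate-≡ (suc m) D u = ≈-trans (sum-*-adjugate m D u u)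
  (det-cong (suc m) λ a b → ≈-reflexive (cong (λ row → row b) (updateAt-id-local u D refl a)))

sum-*-adjugate-≢ : ∀ m (D : Mat m) v u → v ≢ u → sum (λ w → D v w *P adjugate m D w u) ≈ 0#
sum-*-adjugate-≢ (suc m) D v u v≢u = ≈-trans (sum-*-adjugate m D v u)
  (det-equalRows (suc m) (updateAt D u (const (D v))) u v (v≢u ∘ ≡.sym) λ b → ≈-reflexive (≡.trans
    (cong (λ row → row b) (updateAt-updates u D))
    (cong (λ row → row b) (≡.sym (updateAt-minimal v u D v≢u)))))

-- Degree bounds and monic polynomials

record DegreeAtMost (d : ℕ) (p : Poly) : Set where
  constructor degreeAtMost
  field coeff-beyond : ∀ k → d < k → coeff p k ≡ + 0
open DegreeAtMost public

Monic : ℕ → Poly → Set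
Monic d p = DegreeAtMost d p × coeff p d ≡ + 1

degreeAtMost-length : ∀ p → DegreeAtMost (length p) p
degreeAtMost-length p = degreeAtMost (beyond p)
  where
  beyond : ∀ p k → length p < k → coeff p k ≡ + 0
  beyond []      k       _           = refl
  beyond (c ∷ p) (suc k) (s≤s len<k) = beyond p k len<k

degreeAtMost-≈ : ∀ {d p q} → p ≈ q → DegreeAtMost d p → DegreeAtMost d q
degreeAtMost-≈ (mk≋ p≡q) (degreeAtMost p≤d) = degreeAtMost λ k d<k → ≡.trans (≡.sym (p≡q k)) (p≤d k d<k)

degreeAtMost-mono : ∀ {d e p} → d ℕ.≤ e → DegreeAtMost d p → DegreeAtMost e p
degreeAtMost-mono d≤e (degreeAtMost p≤d) = degreeAtMost λ k e<k → p≤d k (ℕ.<-≤-trans (s≤s d≤e) e<k)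

degreeAtMost-+P : ∀ {d p q} → DegreeAtMost d p → DegreeAtMost d q → DegreeAtMost d (p +P q)
degreeAtMost-+P {p = p} {q} (degreeAtMost p≤d) (degreeAtMost q≤d) = degreeAtMost λ k d<k →
  ≡.trans (coeff-+P p q k) (cong₂ ℤ._+_ (p≤d k d<k) (q≤d k d<k))

degreeAtMost-·P : ∀ {d q} a → DegreeAtMost d q → DegreeAtMost d (a ·P q)
degreeAtMost-·P {q = q} a (degreeAtMost q≤d) = degreeAtMost λ k d<k →
  ≡.trans (coeff-·P a q k) (≡.trans (cong (a ℤ.*_) (q≤d k d<k)) (ℤ.*-zeroʳ a))

degreeAtMost-0# : ∀ {d p} → p ≈ 0# → DegreeAtMost d p
degreeAtMost-0# (mk≋ p≡0) = degreeAtMost λ k _ → p≡0 k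

private
  tail-degreeAtMost : ∀ {a c p} → DegreeAtMost (suc a) (c ∷ p) → DegreeAtMost a p
  tail-degreeAtMost (degreeAtMost p≤a) = degreeAtMost λ k a<k → p≤a (suc k) (s≤s a<k)

  tail≈0 : ∀ {c p} → DegreeAtMost 0 (c ∷ p) → p ≈ 0#
  tail≈0 (degreeAtMost p≤0) = mk≋ λ k → p≤0 (suc k) (s≤s z≤n)

  shift≈0 : ∀ {r} → r ≈ 0# → (+ 0 ∷ r) ≈ 0#
  shift≈0 (mk≋ r≡0) = mk≋ λ { zero → refl ; (suc k) → r≡0 k }

  shift-degreeAtMost : ∀ {e r} → DegreeAtMost e r → DegreeAtMost (suc e) (+ 0 ∷ r)
  shift-degreeAtMost (degreeAtMost r≤e) = degreeAtMost λ { (suc k) (s≤s e<k) → r≤e k e<k }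

degreeAtMost-*P : ∀ {a d p q} → DegreeAtMost a p → DegreeAtMost d q → DegreeAtMost (a ℕ.+ d) (p *P q)
degreeAtMost-*P {p = []} _ _ = degreeAtMost λ _ _ → refl
degreeAtMost-*P {zero} {d} {c ∷ p} {q} p≤0 q≤d = degreeAtMost-+P (degreeAtMost-·P c q≤d)
  (degreeAtMost-0# (shift≈0 (≈-trans (*P-congʳ q (tail≈0 p≤0)) (zeroˡ q))))
degreeAtMost-*P {suc a} {d} {c ∷ p} {q} p≤a q≤d = degreeAtMost-+P
  (degreeAtMost-mono (ℕ.m≤n+m d (suc a)) (degreeAtMost-·P c q≤d))
  (shift-degreeAtMost (degreeAtMost-*P (tail-degreeAtMost p≤a) q≤d))

coeff-*P-top : ∀ {a d p q} → DegreeAtMost a p → DegreeAtMost d q →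
               coeff (p *P q) (a ℕ.+ d) ≡ coeff p a ℤ.* coeff q d
coeff-*P-top {p = []} _ _ = refl
coeff-*P-top {a} {d} {c ∷ p} {q} p≤a q≤d = ≡.trans (coeff-+P (c ·P q) (+ 0 ∷ p *P q) (a ℕ.+ d))
  (≡.trans (cong₂ ℤ._+_ (coeff-·P c q (a ℕ.+ d)) refl) (split a p≤a))
  where
  split : ∀ a → DegreeAtMost a (c ∷ p) →
          c ℤ.* coeff q (a ℕ.+ d) ℤ.+ coeff (+ 0 ∷ p *P q) (a ℕ.+ d) ≡ coeff (c ∷ p) a ℤ.* coeff q d
  split zero p≤0 = ≡.trans (cong (λ t → c ℤ.* coeff q d ℤ.+ t)
                              (coeff-≡ (shift≈0 (≈-trans (*P-congʳ q (tail≈0 p≤0)) (zeroˡ q))) d))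
                           (ℤ.+-identityʳ _)
  split (suc a) p≤a = ≡.trans
    (cong₂ ℤ._+_ (≡.trans (cong (c ℤ.*_) (coeff-beyond q≤d (suc a ℕ.+ d) (s≤s (ℕ.m≤n+m d a))))
                          (ℤ.*-zeroʳ c))
                 (coeff-*P-top (tail-degreeAtMost p≤a) q≤d))
    (ℤ.+-identityˡ _)

monic-*P : ∀ {a d p q} → Monic a p → Monic d q → Monic (a ℕ.+ d) (p *P q)
monic-*P (p≤a , p₁) (q≤d , q₁) =
  degreeAtMost-*P p≤a q≤d , ≡.trans (coeff-*P-top p≤a q≤d) (cong₂ ℤ._*_ p₁ q₁)

IsMonic : Poly → Set
IsMonic p = ∃ λ d → Monic d p

isMonic-*P : ∀ {p q} → IsMonic p → IsMonic q → IsMonic (p *P q)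
isMonic-*P (a , p-monic) (d , q-monic) = a ℕ.+ d , monic-*P p-monic q-monic

isMonic-prod : ∀ {n} (f : Fin n → Poly) → (∀ i → IsMonic (f i)) → IsMonic (prod f)
isMonic-prod {zero}  f _       = 0 , degreeAtMost (λ { (suc k) _ → refl }) , refl
isMonic-prod {suc n} f monic = isMonic-*P (monic zero) (isMonic-prod (f ∘ suc) (monic ∘ suc))

*P-monic-zero : ∀ {d q} → Monic d q → ∀ {p} → p *P q ≈ 0# → p ≈ 0#
*P-monic-zero {d} {q} (q≤d , q₁) {p} pq≈0 = go (length p) (degreeAtMost-length p)
  where
  top≡0 : ∀ {a} → DegreeAtMost a p → coeff p a ≡ + 0
  top≡0 {a} p≤a = ≡.trans (≡.sym (ℤ.*-identityʳ (coeff p a)))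
    (≡.trans (cong (coeff p a ℤ.*_) (≡.sym q₁))
    (≡.trans (≡.sym (coeff-*P-top p≤a q≤d)) (coeff-≡ pq≈0 (a ℕ.+ d))))
  go : ∀ a → DegreeAtMost a p → p ≈ 0#
  go zero    p≤0 = mk≋ λ { zero → top≡0 p≤0 ; (suc k) → coeff-beyond p≤0 (suc k) (s≤s z≤n) }
  go (suc a) p≤a = go a (degreeAtMost λ k a<k → case (ℕ.m≤n⇒m<n∨m≡n a<k))
    where
    case : ∀ {k} → suc a < k ⊎ suc a ≡ k → coeff p k ≡ + 0
    case (inj₁ a+1<k) = coeff-beyond p≤a _ a+1<k
    case (inj₂ refl)  = top≡0 p≤a

*P-cancelˡ-monic : ∀ {q} → IsMonic q → ∀ {x y} → q *P x ≈ q *P y → x ≈ y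
*P-cancelˡ-monic {q} (_ , monic) {x} {y} qx≈qy = x∙y⁻¹≈ε⇒x≈y x y (*P-monic-zero monic (begin
  (x +P -P y) *P q          ≈⟨ expand x y q ⟩
  q *P x +P -P (q *P y)     ≈⟨ +P-congʳ (-P (q *P y)) qx≈qy ⟩
  q *P y +P -P (q *P y)     ≈⟨ -‿inverseʳ (q *P y) ⟩
  0#                        ∎))
  where
  expand : ∀ x y q → (x +P -P y) *P q ≈ q *P x +P -P (q *P y)
  expand = solve-∀ ℤ[λ]-ACR

-- Homogenisation

degreeAtMost₁-≈ : ∀ {p} → DegreeAtMost 1 p → p ≈ (coeff p 0 ∷ coeff p 1 ∷ [])
degreeAtMost₁-≈ p≤1 = mk≋ λ
  { zero          → refl
  ; (suc zero)    → refl
  ; (suc (suc k)) → coeff-beyond p≤1 (suc (suc k)) (s≤s (s≤s z≤n))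
  }

-- hom d c = Σ_{k ≤ d} c k x^k y^(d-k), the degree-d homogenisation of
-- Σ_k c k λ^k evaluated at (x , y).
module Homogenisation (x y : Poly) where

  hom : ℕ → (ℕ → ℤ) → Poly
  hom zero    c = constP (c 0)
  hom (suc d) c = constP (c 0) *P y ^ suc d +P x *P hom d (c ∘ suc)

  homP : ℕ → Poly → Poly
  homP d p = hom d (coeff p)

  hom₁ : Poly → Poly
  hom₁ p = constP (coeff p 0) *P y +P constP (coeff p 1) *P x

  hom-cong : ∀ d {c c′ : ℕ → ℤ} → (∀ k → c k ≡ c′ k) → hom d c ≈ hom d c′
  hom-cong zero    c≡c′ = ≈-reflexive (cong constP (c≡c′ 0))
  hom-cong (suc d) c≡c′ = +-cong (*P-congʳ (y ^ suc d) (≈-reflexive (cong constP (c≡c′ 0))))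
                                 (*P-congˡ x (hom-cong d (c≡c′ ∘ suc)))

  homP-cong : ∀ d {p q} → p ≈ q → homP d p ≈ homP d q
  homP-cong d (mk≋ p≡q) = hom-cong d p≡q

  hom-+ : ∀ d (c c′ : ℕ → ℤ) → hom d (λ k → c k ℤ.+ c′ k) ≈ hom d c +P hom d c′
  hom-+ zero    c c′ = ≈-refl
  hom-+ (suc d) c c′ = ≈-trans
    (+P-congˡ (constP (c 0 ℤ.+ c′ 0) *P y ^ suc d) (*P-congˡ x (hom-+ d (c ∘ suc) (c′ ∘ suc))))
    (regroup x (constP (c 0)) (constP (c′ 0)) (y ^ suc d) (hom d (c ∘ suc)) (hom d (c′ ∘ suc)))
    where
    regroup : ∀ x a b Y h h′ → (a +P b) *P Y +P x *P (h +P h′) ≈ a *P Y +P x *P h +P (b *P Y +P x *P h′)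
    regroup = solve-∀ ℤ[λ]-ACR

  hom-scale : ∀ d s (c : ℕ → ℤ) → hom d (λ k → s ℤ.* c k) ≈ constP s *P hom d c
  hom-scale zero    s c = ≈-sym (constP-* s (c 0))
  hom-scale (suc d) s c = ≈-trans
    (+-cong (*P-congʳ (y ^ suc d) (≈-sym (constP-* s (c 0)))) (*P-congˡ x (hom-scale d s (c ∘ suc))))
    (regroup x (constP s) (constP (c 0)) (y ^ suc d) (hom d (c ∘ suc)))
    where
    regroup : ∀ x s a Y h → (s *P a) *P Y +P x *P (s *P h) ≈ s *P (a *P Y +P x *P h)
    regroup = solve-∀ ℤ[λ]-ACR

  hom-zero : ∀ d (c : ℕ → ℤ) → (∀ k → c k ≡ + 0) → hom d c ≈ 0#
  hom-zero zero    c c≡0 = mk≋ λ { zero → c≡0 0 ; (suc k) → refl }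
  hom-zero (suc d) c c≡0 = ≈-trans
    (+-cong (*P-congʳ (y ^ suc d) (hom-zero zero c c≡0)) (*P-congˡ x (hom-zero d (c ∘ suc) (c≡0 ∘ suc))))
    (≈-trans (+-cong (zeroˡ (y ^ suc d)) (zeroʳ x)) (+-identityʳ 0#))

  shift : (ℕ → ℤ) → ℕ → ℤ
  shift c zero    = + 0
  shift c (suc k) = c k

  hom-shift : ∀ d (c : ℕ → ℤ) → hom (suc d) (shift c) ≈ x *P hom d c
  hom-shift d c = ≈-trans (+P-congʳ (x *P hom d c)
    (≈-trans (*P-congʳ (y ^ suc d) constP-0) (zeroˡ (y ^ suc d))))
    (+-identityˡ (x *P hom d c))

  hom-raise : ∀ d (c : ℕ → ℤ) → (∀ k → d < k → c k ≡ + 0) → hom (suc d) c ≈ y *P hom d c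
  hom-raise zero    c c≤0 = begin
    constP (c 0) *P (y *P 1#) +P x *P constP (c 1)
      ≈⟨ +P-congˡ (constP (c 0) *P (y *P 1#))
           (≈-trans (*P-congˡ x (≈-trans (≈-reflexive (cong constP (c≤0 1 (s≤s z≤n)))) constP-0))
                                                       (zeroʳ x)) ⟩
    constP (c 0) *P (y *P 1#) +P 0#
      ≈⟨ regroup y (constP (c 0)) ⟩
    y *P constP (c 0) ∎
    where
    regroup : ∀ y a → a *P (y *P 1#) +P 0# ≈ y *P a
    regroup y a = ≈-trans (+-identityʳ (a *P (y *P 1#))) (≈-trans (*P-congˡ a (*-identityʳ y)) (*-comm a y))
  hom-raise (suc d) c c≤d = ≈-trans
    (+P-congˡ (constP (c 0) *P y ^ suc (suc d))
      (*P-congˡ x (hom-raise d (c ∘ ℕ.suc) λ k d<k → c≤d (suc k) (s≤s d<k))))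
    (regroup x y (constP (c 0)) (y ^ suc d) (hom d (c ∘ ℕ.suc)))
    where
    regroup : ∀ x y a Y h → a *P (y *P Y) +P x *P (y *P h) ≈ y *P (a *P Y +P x *P h)
    regroup = solve-∀ ℤ[λ]-ACR

  homP-+P : ∀ d p q → homP d (p +P q) ≈ homP d p +P homP d q
  homP-+P d p q = ≈-trans (hom-cong d (coeff-+P p q)) (hom-+ d (coeff p) (coeff q))

  homP-constP-*P : ∀ d a p → homP d (constP a *P p) ≈ constP a *P homP d p
  homP-constP-*P d a p = ≈-trans (hom-cong d (coeff-constP-*P a p)) (hom-scale d a (coeff p))

  homP-sum : ∀ d {n} (f : Fin n → Poly) → homP d (sum f) ≈ sum (λ i → homP d (f i))
  homP-sum d {zero}  f = hom-zero d (λ _ → + 0) (λ _ → refl)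
  homP-sum d {suc n} f = ≈-trans (homP-+P d (f zero) (sum (f ∘ suc)))
                                 (+P-congˡ (homP d (f zero)) (homP-sum d (f ∘ suc)))

  homP-linear-*P : ∀ d {L D} → DegreeAtMost 1 L → DegreeAtMost d D →
                   homP (suc d) (L *P D) ≈ hom₁ L *P homP d D
  homP-linear-*P d {L} {D} L≤1 D≤d = begin
    homP (suc d) (L *P D)
      ≈⟨ homP-cong (suc d) (*P-congʳ D (degreeAtMost₁-≈ L≤1)) ⟩
    hom (suc d) (coeff ((a ∷ b ∷ []) *P D))
      ≈⟨ hom-cong (suc d) coeff-L*D ⟩
    hom (suc d) (λ k → a ℤ.* coeff D k ℤ.+ shift (λ j → b ℤ.* coeff D j) k)
      ≈⟨ hom-+ (suc d) (λ k → a ℤ.* coeff D k) (shift (λ j → b ℤ.* coeff D j)) ⟩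
    hom (suc d) (λ k → a ℤ.* coeff D k) +P hom (suc d) (shift (λ j → b ℤ.* coeff D j))
      ≈⟨ +-cong (≈-trans (hom-scale (suc d) a (coeff D))
                         (*P-congˡ (constP a) (hom-raise d (coeff D) (coeff-beyond D≤d))))
                (≈-trans (hom-shift d (λ j → b ℤ.* coeff D j)) (*P-congˡ x (hom-scale d b (coeff D)))) ⟩
    constP a *P (y *P homP d D) +P x *P (constP b *P homP d D)
      ≈⟨ regroup x y (constP a) (constP b) (homP d D) ⟩
    hom₁ L *P homP d D ∎
    where
    a b : ℤ
    a = coeff L 0
    b = coeff L 1
    coeff-L*D : ∀ k → coeff ((a ∷ b ∷ []) *P D) k ≡ a ℤ.* coeff D k ℤ.+ shift (λ j → b ℤ.* coeff D j) k
    coeff-L*D k = ≡.trans (coeff-+P (a ·P D) (+ 0 ∷ constP b *P D) k) (cong₂ ℤ._+_ (coeff-·P a D k) (tail k))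
      where
      tail : ∀ k → coeff (+ 0 ∷ constP b *P D) k ≡ shift (λ j → b ℤ.* coeff D j) k
      tail zero    = refl
      tail (suc j) = coeff-constP-*P b D j
    regroup : ∀ x y A B h → A *P (y *P h) +P x *P (B *P h) ≈ (A *P y +P B *P x) *P h
    regroup = solve-∀ ℤ[λ]-ACR

degreeAtMost-sum : ∀ {d n} (f : Fin n → Poly) → (∀ i → DegreeAtMost d (f i)) → DegreeAtMost d (sum f)
degreeAtMost-sum {n = zero}  f _   = degreeAtMost λ _ _ → refl
degreeAtMost-sum {n = suc n} f f≤d = degreeAtMost-+P (f≤d zero) (degreeAtMost-sum (f ∘ suc) (f≤d ∘ suc))

-1^-degreeAtMost : ∀ k → DegreeAtMost 0 (-1^ k)
-1^-degreeAtMost k = degreeAtMost-≈ (-1^-parity k) (degreeAtMost λ { (suc k) _ → refl })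

det-degreeAtMost : ∀ n (M : Mat n) → (∀ i j → DegreeAtMost 1 (M i j)) → DegreeAtMost n (det n M)
det-degreeAtMost zero    M _   = degreeAtMost λ { (suc k) _ → refl }
det-degreeAtMost (suc n) M M≤1 = degreeAtMost-≈ (≈-sym (det-suc n M)) (degreeAtMost-sum _ λ j →
  degreeAtMost-*P (degreeAtMost-*P (-1^-degreeAtMost (toℕ j)) (M≤1 zero j))
                  (det-degreeAtMost n (minor zero j M) λ a b → M≤1 (suc a) (punchIn j b)))

module _ (x y : Poly) where
  open Homogenisation x y

  det-hom₁ : ∀ n (M : Mat n) → (∀ i j → DegreeAtMost 1 (M i j)) →
             det n (λ i j → hom₁ (M i j)) ≈ homP n (det n M)
  det-hom₁ zero    M _   = ≈-refl
  det-hom₁ (suc n) M M≤1 = ≈-sym (begin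
    homP (suc n) (det (suc n) M)
      ≈⟨ homP-cong (suc n) (det-suc n M) ⟩
    homP (suc n) (sum (λ j → -1^ toℕ j *P M zero j *P D j))
      ≈⟨ homP-sum (suc n) (λ j → -1^ toℕ j *P M zero j *P D j) ⟩
    sum (λ j → homP (suc n) (-1^ toℕ j *P M zero j *P D j))
      ≈⟨ sum-cong-≋ term ⟩
    sum (λ j → -1^ toℕ j *P hom₁ (M zero j) *P det n (λ a b → hom₁ (minor zero j M a b)))
      ≈⟨ det-suc n (λ a b → hom₁ (M a b)) ⟨
    det (suc n) (λ a b → hom₁ (M a b)) ∎)
    where
    D : Fin (suc n) → Poly
    D j = det n (minor zero j M)
    term : ∀ j → homP (suc n) (-1^ toℕ j *P M zero j *P D j)
                 ≈ -1^ toℕ j *P hom₁ (M zero j) *P det n (λ a b → hom₁ (minor zero j M a b))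
    term j = begin
      homP (suc n) (-1^ toℕ j *P M zero j *P D j)
        ≈⟨ homP-cong (suc n) (≈-trans (*-assoc (-1^ toℕ j) (M zero j) (D j))
                                      (*P-congʳ (M zero j *P D j) (≈-sym (-1^-parity (toℕ j))))) ⟩
      homP (suc n) (constP (parity (toℕ j)) *P (M zero j *P D j))
        ≈⟨ homP-constP-*P (suc n) (parity (toℕ j)) (M zero j *P D j) ⟩
      constP (parity (toℕ j)) *P homP (suc n) (M zero j *P D j)
        ≈⟨ *-cong (-1^-parity (toℕ j)) (homP-linear-*P n (M≤1 zero j)
             (det-degreeAtMost n (minor zero j M) λ a b → M≤1 (suc a) (punchIn j b))) ⟩
      -1^ toℕ j *P (hom₁ (M zero j) *P homP n (D j))
        ≈⟨ *P-congˡ (-1^ toℕ j) (*P-congˡ (hom₁ (M zero j))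
             (≈-sym (det-hom₁ n (minor zero j M) λ a b → M≤1 (suc a) (punchIn j b)))) ⟩
      -1^ toℕ j *P (hom₁ (M zero j) *P det n (λ a b → hom₁ (minor zero j M a b)))
        ≈⟨ *-assoc (-1^ toℕ j) (hom₁ (M zero j)) _ ⟨
      -1^ toℕ j *P hom₁ (M zero j) *P det n (λ a b → hom₁ (minor zero j M a b)) ∎

private
  coeff-adjEntry : ∀ a k → coeff (adjEntry a) (suc k) ≡ + 0
  coeff-adjEntry (just s) k = refl
  coeff-adjEntry nothing  k = refl

  coeff--adjEntry : ∀ a k → coeff (-P adjEntry a) (suc k) ≡ + 0
  coeff--adjEntry a k = ≡.trans (coeff--P (adjEntry a) (suc k)) (cong ℤ.-_ (coeff-adjEntry a k))

coeff₁-charMat : ∀ {n} (e : Edges n) i j → coeff (charMat e i j) 1 ≡ δ i j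
coeff₁-charMat e i j with i Fin.≟ j
... | yes _ = ≡.trans (coeff-+P X (-P adjEntry (e i j)) 1) (cong (λ t → + 1 ℤ.+ t) (coeff--adjEntry (e i j) 0))
... | no  _ = coeff--adjEntry (e i j) 0

charMat-degreeAtMost₁ : ∀ {n} (e : Edges n) i j → DegreeAtMost 1 (charMat e i j)
charMat-degreeAtMost₁ e i j = degreeAtMost λ { (suc (suc k)) (s≤s (s≤s _)) → beyond k }
  where
  beyond : ∀ k → coeff (charMat e i j) (suc (suc k)) ≡ + 0
  beyond k with i Fin.≟ j
  ... | yes _ = ≡.trans (coeff-+P X (-P adjEntry (e i j)) (suc (suc k)))
                  (≡.trans (ℤ.+-identityˡ _) (coeff--adjEntry (e i j) (suc k)))
  ... | no  _ = coeff--adjEntry (e i j) (suc k)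

-- Homogenising with x = 1 and y = 0 reads off the leading coefficient,
-- and turns λI - A into the identity matrix.
charPolyE-monic : ∀ m (e : Edges m) → Monic m (charPolyE e)
charPolyE-monic m e = det-degreeAtMost m (charMat e) (charMat-degreeAtMost₁ e) , coeff-≡ leading 0
  where
  open Homogenisation 1# 0#

  hom-top : ∀ d c → hom d c ≈ constP (c d)
  hom-top zero    c = ≈-refl
  hom-top (suc d) c = ≈-trans
    (+-cong (zeroʳ (constP (c 0))) (≈-trans (*-identityˡ (hom d (c ∘ ℕ.suc))) (hom-top d (c ∘ ℕ.suc))))
                              (+-identityˡ (constP (c (suc d))))

  hom₁-charMat : ∀ i j → hom₁ (charMat e i j) ≈ constP (δ i j)
  hom₁-charMat i j = ≈-trans
    (+-cong (zeroʳ (constP (coeff (charMat e i j) 0))) (*-identityʳ (constP (coeff (charMat e i j) 1))))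
    (≈-trans (+-identityˡ (constP (coeff (charMat e i j) 1))) (≈-reflexive (cong constP (coeff₁-charMat e i j))))

  leading : constP (coeff (charPolyE e) m) ≈ 1#
  leading = begin
    constP (coeff (charPolyE e) m)            ≈⟨ hom-top m (coeff (charPolyE e)) ⟨
    homP m (charPolyE e)                      ≈⟨ det-hom₁ 1# 0# m (charMat e) (charMat-degreeAtMost₁ e) ⟨
    det m (λ i j → hom₁ (charMat e i j))       ≈⟨ det-identity m _ hom₁-charMat ⟩
    1#                                        ∎

-- Indexing the vertices of the corona

Idx : ∀ n → (Fin n → ℕ) → Set
Idx n m = Σ (Fin n) (λ l → Fin (m l))

module _ {n} (m : Fin (suc n) → ℕ) where
  private
    T′ : ℕ
    T′ = total n (m ∘ suc)

  decode-↑ˡ : ∀ w → decode (suc n) m (w ↑ˡ T′) ≡ (zero , w)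
  decode-↑ˡ w rewrite Fin.splitAt-↑ˡ (m zero) w T′ = refl

  decode-↑ʳ : ∀ k → decode (suc n) m (m zero ↑ʳ k) ≡
              (suc (proj₁ (decode n (m ∘ suc) k)) , proj₂ (decode n (m ∘ suc) k))
  decode-↑ʳ k rewrite Fin.splitAt-↑ʳ (m zero) T′ k = refl

encode : ∀ n (m : Fin n → ℕ) → Idx n m → Fin (total n m)
encode (suc n) m (zero  , w) = w ↑ˡ total n (m ∘ suc)
encode (suc n) m (suc l , w) = m zero ↑ʳ encode n (m ∘ suc) (l , w)

encode-decode : ∀ n (m : Fin n → ℕ) t → encode n m (decode n m t) ≡ t
encode-decode (suc n) m t with splitAt (m zero) t in eq
... | inj₁ w = Fin.splitAt⁻¹-↑ˡ eq
... | inj₂ k with decode n (m ∘ suc) k | encode-decode n (m ∘ suc) k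
...   | l , w | encode-decode-k = ≡.trans (cong (m zero ↑ʳ_) encode-decode-k) (Fin.splitAt⁻¹-↑ʳ eq)

decode-injective : ∀ n (m : Fin n → ℕ) {s t} → decode n m s ≡ decode n m t → s ≡ t
decode-injective n m {s} {t} eq =
  ≡.trans (≡.sym (encode-decode n m s)) (≡.trans (cong (encode n m) eq) (encode-decode n m t))

sum-decode : ∀ n (m : Fin n → ℕ) (F : Idx n m → Poly) →
  sum (λ t → F (decode n m t)) ≈ sum (λ l → sum (λ w → F (l , w)))
sum-decode zero    m F = ≈-refl
sum-decode (suc n) m F = begin
  sum (λ t → F (decode (suc n) m t))
    ≈⟨ sum-↑-split +-monoid (m zero) (total n (m ∘ suc)) (λ t → F (decode (suc n) m t)) ⟩
  sum (λ w → F (decode (suc n) m (w ↑ˡ total n (m ∘ suc)))) +P sum (λ k → F (decode (suc n) m (m zero ↑ʳ k)))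
    ≈⟨ +-cong (sum-cong-≋ λ w → ≈-reflexive (cong F (decode-↑ˡ m w)))
              (≈-trans (sum-cong-≋ λ k → ≈-reflexive (cong F (decode-↑ʳ m k)))
                       (sum-decode n (m ∘ suc) (λ (l , w) → F (suc l , w)))) ⟩
  sum (λ w → F (zero , w)) +P sum (λ l → sum (λ w → F (suc l , w))) ∎

blockDiagonal : ∀ {n} {m : Fin n → ℕ} → ((l : Fin n) → Mat (m l)) → Idx n m → Idx n m → Poly
blockDiagonal D (l , w) (l′ , w′) with l Fin.≟ l′
... | yes refl = D l w w′
... | no  _    = 0#

det-blockDiagonal : ∀ n (m : Fin n → ℕ) (D : (l : Fin n) → Mat (m l)) →
  det (total n m) (λ s t → blockDiagonal D (decode n m s) (decode n m t)) ≈ prod (λ l → det (m l) (D l))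
det-blockDiagonal zero    m D = ≈-refl
det-blockDiagonal (suc n) m D = ≈-trans
  (det-blockLowerTriangular (m zero) T′ B upper0)
  (*-cong (det-cong (m zero) diag₀) (≈-trans (det-cong T′ diag₁) (det-blockDiagonal n (m ∘ suc) (D ∘ suc))))
  where
  T′ : ℕ
  T′ = total n (m ∘ suc)
  B : Mat (m zero ℕ.+ T′)
  B s t = blockDiagonal D (decode (suc n) m s) (decode (suc n) m t)
  upper0 : ∀ i t → B (i ↑ˡ T′) (m zero ↑ʳ t) ≈ 0#
  upper0 i t rewrite decode-↑ˡ m i | decode-↑ʳ m t = ≈-refl
  diag₀ : ∀ a b → B (a ↑ˡ T′) (b ↑ˡ T′) ≈ D zero a b
  diag₀ a b rewrite decode-↑ˡ m a | decode-↑ˡ m b = ≈-refl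
  diag₁ : ∀ s t → B (m zero ↑ʳ s) (m zero ↑ʳ t) ≈
                  blockDiagonal (D ∘ suc) (decode n (m ∘ suc) s) (decode n (m ∘ suc) t)
  diag₁ s t rewrite decode-↑ʳ m s | decode-↑ʳ m t
    with decode n (m ∘ suc) s | decode n (m ∘ suc) t
  ... | l , w | l′ , w′ with l Fin.≟ l′
  ... | yes refl = ≈-refl
  ... | no  _    = ≈-refl

-- Entries of λI - A for the corona

↑ˡ≢↑ʳ : ∀ {n T} (l : Fin n) (t : Fin T) → l ↑ˡ T ≢ n ↑ʳ t
↑ˡ≢↑ʳ {n} {T} l t eq
  with ≡.trans (≡.sym (Fin.splitAt-↑ˡ n l T)) (≡.trans (cong (splitAt n) eq) (Fin.splitAt-↑ʳ n T t))
... | ()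

charMat-reindex : ∀ {a b} (ρ : Fin a → Fin b) → (∀ {i j} → ρ i ≡ ρ j → i ≡ j) →
  (e : Edges b) (e′ : Edges a) → ∀ i j → e (ρ i) (ρ j) ≡ e′ i j → charMat e (ρ i) (ρ j) ≡ charMat e′ i j
charMat-reindex ρ ρ-inj e e′ i j e≡e′ with ρ i Fin.≟ ρ j | i Fin.≟ j
... | yes _     | yes _   = cong (λ a → X +P -P adjEntry a) e≡e′
... | yes ρi≡ρj | no  i≢j = ⊥-elim (i≢j (ρ-inj ρi≡ρj))
... | no  ρi≢ρj | yes i≡j = ⊥-elim (ρi≢ρj (cong ρ i≡j))
... | no  _     | no  _   = cong (λ a → -P adjEntry a) e≡e′

charMat-≢ : ∀ {b} (e : Edges b) {x y} → x ≢ y → charMat e x y ≡ -P adjEntry (e x y)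
charMat-≢ e {x} {y} x≢y with x Fin.≟ y
... | yes x≡y = ⊥-elim (x≢y x≡y)
... | no  _   = refl

charMat-sym : ∀ {m} (H : SignedGraph m) i j → charMat (edge H) i j ≡ charMat (edge H) j i
charMat-sym H i j with i Fin.≟ j | j Fin.≟ i
... | yes _   | yes _   = cong (λ a → X +P -P adjEntry a) (SignedGraph.sym H i j)
... | yes i≡j | no  j≢i = ⊥-elim (j≢i (≡.sym i≡j))
... | no  i≢j | yes j≡i = ⊥-elim (i≢j (≡.sym j≡i))
... | no  _   | no  _   = cong (λ a → -P adjEntry a) (SignedGraph.sym H i j)

signP : Sign → Poly
signP s = constP (signℤ s)

signP-* : ∀ s t → signP (s Sign.* t) ≈ signP s *P signP t
signP-* Sign.+ Sign.+ = mk≋ λ { zero → refl ; (suc k) → refl }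
signP-* Sign.+ Sign.- = mk≋ λ { zero → refl ; (suc k) → refl }
signP-* Sign.- Sign.+ = mk≋ λ { zero → refl ; (suc k) → refl }
signP-* Sign.- Sign.- = mk≋ λ { zero → refl ; (suc k) → refl }

signP-² : ∀ s → signP s *P signP s ≈ 1#
signP-² Sign.+ = mk≋ λ { zero → refl ; (suc k) → refl }
signP-² Sign.- = mk≋ λ { zero → refl ; (suc k) → refl }

coronalNum-sum : ∀ {m} (H : SignedGraph m) → coronalNum H ≈ sum (λ u → sum (λ w →
  signP (marking H u) *P adjugate m (charMat (edge H)) u w *P signP (marking H w)))
coronalNum-sum {m} H = ≈-trans (≈-reflexive (sumFin≡sum λ u → sumFin (term u)))
                               (sum-cong-≋ λ u → ≈-reflexive (sumFin≡sum (term u)))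
  where
  term : Fin m → Fin m → Poly
  term u w = signP (marking H u) *P adjugate m (charMat (edge H)) u w *P signP (marking H w)

module Corona {n} (G : SignedGraph n) (m : Fin n → ℕ) (H : (l : Fin n) → SignedGraph (m l)) where

  T : ℕ
  T = total n m
  M : Mat (n ℕ.+ T)
  M = charMat (coronaEdges G m H)
  P : Mat n
  P = charMat (edge G)
  D : (l : Fin n) → Mat (m l)
  D l = charMat (edge (H l))
  f N : Fin n → Poly
  f l = charPoly (H l)
  N l = coronalNum (H l)
  μ : Fin n → Sign
  μ = marking G
  μ′ : (l : Fin n) → Fin (m l) → Sign
  μ′ l = marking (H l)

  link : Fin n → Idx n m → Maybe Sign
  link u (l , w) with u Fin.≟ l
  ... | yes _ = just (μ u Sign.* μ′ l w)
  ... | no  _ = nothing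

  private
    E : Edges (n ℕ.+ T)
    E = coronaEdges G m H

    E-↑ˡ↑ˡ : ∀ i j → E (i ↑ˡ T) (j ↑ˡ T) ≡ edge G i j
    E-↑ˡ↑ˡ i j rewrite Fin.splitAt-↑ˡ n i T | Fin.splitAt-↑ˡ n j T = refl

    E-↑ˡ↑ʳ : ∀ i t → E (i ↑ˡ T) (n ↑ʳ t) ≡ link i (decode n m t)
    E-↑ˡ↑ʳ i t rewrite Fin.splitAt-↑ˡ n i T | Fin.splitAt-↑ʳ n T t with decode n m t
    ... | l , w with i Fin.≟ l
    ...   | yes _ = refl
    ...   | no  _ = refl

    E-↑ʳ↑ˡ : ∀ t i → E (n ↑ʳ t) (i ↑ˡ T) ≡ link i (decode n m t)
    E-↑ʳ↑ˡ t i rewrite Fin.splitAt-↑ˡ n i T | Fin.splitAt-↑ʳ n T t with decode n m t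
    ... | l , w with i Fin.≟ l
    ...   | yes _ = refl
    ...   | no  _ = refl

    inner : Idx n m → Idx n m → Maybe Sign
    inner (l , w) (l′ , w′) with l Fin.≟ l′
    ... | yes refl = edge (H l) w w′
    ... | no  _    = nothing

    E-↑ʳ↑ʳ : ∀ s t → E (n ↑ʳ s) (n ↑ʳ t) ≡ inner (decode n m s) (decode n m t)
    E-↑ʳ↑ʳ s t rewrite Fin.splitAt-↑ʳ n T s | Fin.splitAt-↑ʳ n T t with decode n m s | decode n m t
    ... | l , w | l′ , w′ with l Fin.≟ l′
    ...   | yes refl = refl
    ...   | no  _    = refl

    charMat-inner : ∀ s t → charMat (λ a b → inner (decode n m a) (decode n m b)) s t ≈
                            blockDiagonal D (decode n m s) (decode n m t)
    charMat-inner s t with s Fin.≟ t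
    ... | yes refl = diagonal (decode n m s)
      where
      diagonal : ∀ p → X +P -P adjEntry (inner p p) ≈ blockDiagonal D p p
      diagonal (l , w) with l Fin.≟ l
      ... | no  l≢l = ⊥-elim (l≢l refl)
      ... | yes refl with w Fin.≟ w
      ...   | yes _   = ≈-refl
      ...   | no  w≢w = ⊥-elim (w≢w refl)
    ... | no  s≢t = offDiagonal (decode n m s) (decode n m t) (s≢t ∘ decode-injective n m)
      where
      offDiagonal : ∀ p q → p ≢ q → -P adjEntry (inner p q) ≈ blockDiagonal D p q
      offDiagonal (l , w) (l′ , w′) p≢q with l Fin.≟ l′
      ... | no  _    = ≈-refl
      ... | yes refl with w Fin.≟ w′
      ...   | yes refl = ⊥-elim (p≢q refl)
      ...   | no  _    = ≈-refl

  M-↑ˡ↑ˡ : ∀ i j → M (i ↑ˡ T) (j ↑ˡ T) ≡ P i j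
  M-↑ˡ↑ˡ i j = charMat-reindex (_↑ˡ T) (Fin.↑ˡ-injective T _ _) E (edge G) i j (E-↑ˡ↑ˡ i j)

  M-↑ˡ↑ʳ : ∀ i t → M (i ↑ˡ T) (n ↑ʳ t) ≡ -P adjEntry (link i (decode n m t))
  M-↑ˡ↑ʳ i t = ≡.trans (charMat-≢ E (↑ˡ≢↑ʳ i t)) (cong (λ a → -P adjEntry a) (E-↑ˡ↑ʳ i t))

  M-↑ʳ↑ˡ : ∀ t i → M (n ↑ʳ t) (i ↑ˡ T) ≡ -P adjEntry (link i (decode n m t))
  M-↑ʳ↑ˡ t i = ≡.trans (charMat-≢ E (↑ˡ≢↑ʳ i t ∘ ≡.sym)) (cong (λ a → -P adjEntry a) (E-↑ʳ↑ˡ t i))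

  M-↑ʳ↑ʳ : ∀ s t → M (n ↑ʳ s) (n ↑ʳ t) ≈ blockDiagonal D (decode n m s) (decode n m t)
  M-↑ʳ↑ʳ s t = ≈-trans
    (≈-reflexive (charMat-reindex (n ↑ʳ_) (Fin.↑ʳ-injective n _ _) E _ s t (E-↑ʳ↑ʳ s t)))
    (charMat-inner s t)

  -- Adding clearing l w times H-row (l , w) to f l times G-row l kills the
  -- entries of that row in the H-columns (the rows of adj (D l) are
  -- orthogonal to the columns of D l).
  clearing : (l : Fin n) → Fin (m l) → Poly
  clearing l w = signP (μ l) *P sum (λ u → signP (μ′ l u) *P adjugate (m l) (D l) w u)

  clearing-column : ∀ l w′ → sum (λ w → clearing l w *P D l w w′) ≈ signP (μ l) *P (signP (μ′ l w′) *P f l)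
  clearing-column l w′ = begin
    sum (λ w → clearing l w *P D l w w′)
      ≈⟨ sum-cong-≋ (λ w → reorder w) ⟩
    sum (λ w → sμ *P sum (λ u → s u *P (D l w′ w *P A w u)))
      ≈⟨ *-distribˡ-sum sμ (λ w → sum (λ u → s u *P (D l w′ w *P A w u))) ⟨
    sμ *P sum (λ w → sum (λ u → s u *P (D l w′ w *P A w u)))
      ≈⟨ *P-congˡ sμ (∑-comm (λ w u → s u *P (D l w′ w *P A w u))) ⟩
    sμ *P sum (λ u → sum (λ w → s u *P (D l w′ w *P A w u)))
      ≈⟨ *P-congˡ sμ (sum-cong-≋ λ u → *-distribˡ-sum (s u) (λ w → D l w′ w *P A w u)) ⟨
    sμ *P sum (λ u → s u *P sum (λ w → D l w′ w *P A w u))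
      ≈⟨ *P-congˡ sμ (sum-single +-monoid (λ u → s u *P sum (λ w → D l w′ w *P A w u)) w′ λ u u≢w′ →
           ≈-trans (*P-congˡ (s u) (sum-*-adjugate-≢ (m l) (D l) w′ u (u≢w′ ∘ ≡.sym))) (zeroʳ (s u))) ⟩
    sμ *P (s w′ *P sum (λ w → D l w′ w *P A w w′))
      ≈⟨ *P-congˡ sμ (*P-congˡ (s w′) (sum-*-adjugate-≡ (m l) (D l) w′)) ⟩
    sμ *P (s w′ *P f l) ∎
    where
    sμ : Poly
    sμ = signP (μ l)
    s : Fin (m l) → Poly
    s u = signP (μ′ l u)
    A : Fin (m l) → Fin (m l) → Poly
    A = adjugate (m l) (D l)
    reorder : ∀ w → clearing l w *P D l w w′ ≈ sμ *P sum (λ u → s u *P (D l w′ w *P A w u))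
    reorder w = begin
      sμ *P sum (λ u → s u *P A w u) *P D l w w′
        ≈⟨ *-assoc sμ (sum (λ u → s u *P A w u)) (D l w w′) ⟩
      sμ *P (sum (λ u → s u *P A w u) *P D l w w′)
        ≈⟨ *P-congˡ sμ (*-distribʳ-sum (D l w w′) (λ u → s u *P A w u)) ⟩
      sμ *P sum (λ u → s u *P A w u *P D l w w′)
        ≈⟨ *P-congˡ sμ (sum-cong-≋ λ u → ≈-trans (regroup (s u) (A w u) (D l w w′))
             (*P-congˡ (s u) (*P-congʳ (A w u) (≈-reflexive (charMat-sym (H l) w w′))))) ⟩
      sμ *P sum (λ u → s u *P (D l w′ w *P A w u)) ∎
      where
      regroup : ∀ s a d → s *P a *P d ≈ s *P (d *P a)
      regroup = solve-∀ ℤ[λ]-ACR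

  clearingAt : Fin n → Idx n m → Poly
  clearingAt l (l′ , w) with l′ Fin.≟ l
  ... | yes refl = clearing l′ w
  ... | no  _    = 0#

  sum-clearingAt : ∀ l (g : Idx n m → Poly) →
    sum (λ t → clearingAt l (decode n m t) *P g (decode n m t)) ≈ sum (λ w → clearing l w *P g (l , w))
  sum-clearingAt l g = begin
    sum (λ t → clearingAt l (decode n m t) *P g (decode n m t))
      ≈⟨ sum-decode n m (λ p → clearingAt l p *P g p) ⟩
    sum (λ l′ → sum (λ w → clearingAt l (l′ , w) *P g (l′ , w)))
      ≈⟨ sum-single +-monoid (λ l′ → sum (λ w → clearingAt l (l′ , w) *P g (l′ , w))) l other ⟩
    sum (λ w → clearingAt l (l , w) *P g (l , w))
      ≈⟨ sum-cong-≋ (λ w → *P-congʳ (g (l , w)) (≈-reflexive (at-l w))) ⟩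
    sum (λ w → clearing l w *P g (l , w)) ∎
    where
    at-l : ∀ w → clearingAt l (l , w) ≡ clearing l w
    at-l w with l Fin.≟ l
    ... | yes refl = refl
    ... | no  l≢l  = ⊥-elim (l≢l refl)
    other : ∀ l′ → l′ ≢ l → sum (λ w → clearingAt l (l′ , w) *P g (l′ , w)) ≈ 0#
    other l′ l′≢l = sum-ε +-monoid (λ w → clearingAt l (l′ , w) *P g (l′ , w)) λ w → zero-at w
      where
      zero-at : ∀ w → clearingAt l (l′ , w) *P g (l′ , w) ≈ 0#
      zero-at w with l′ Fin.≟ l
      ... | yes l′≡l = ⊥-elim (l′≢l l′≡l)
      ... | no  _    = zeroˡ (g (l′ , w))

  clearing-G-to-H : ∀ l p →
    f l *P -P adjEntry (link l p) +P sum (λ w → clearing l w *P blockDiagonal D (l , w) p) ≈ 0#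
  clearing-G-to-H l (l′ , w′) with l Fin.≟ l′
  ... | yes refl = ≈-trans
    (+-cong (*P-congˡ (f l) (-‿cong (signP-* (μ l) (μ′ l w′)))) (clearing-column l w′))
    (cancel (f l) (signP (μ l)) (signP (μ′ l w′)))
    where
    cancel : ∀ F a b → F *P -P (a *P b) +P a *P (b *P F) ≈ 0#
    cancel = solve-∀ ℤ[λ]-ACR
  ... | no  _    = ≈-trans (+-cong (≈-trans (*P-congˡ (f l) -0#≈0#) (zeroʳ (f l)))
                                   (sum-ε +-monoid _ λ w → zeroʳ (clearing l w)))
                           (+-identityʳ 0#)

  clearing-*-ownEdge : ∀ l w → clearing l w *P -P (signP (μ l) *P signP (μ′ l w)) ≈
    -P sum (λ u → signP (μ′ l w) *P adjugate (m l) (D l) w u *P signP (μ′ l u))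
  clearing-*-ownEdge l w = begin
    sμ *P sum (λ u → s u *P A w u) *P -P (sμ *P s w)
      ≈⟨ regroup sμ (sum (λ u → s u *P A w u)) (s w) ⟩
    -P ((sμ *P sμ) *P (s w *P sum (λ u → s u *P A w u)))
      ≈⟨ -‿cong (≈-trans (*P-congʳ (s w *P sum (λ u → s u *P A w u)) (signP-² (μ l)))
                         (*-identityˡ (s w *P sum (λ u → s u *P A w u)))) ⟩
    -P (s w *P sum (λ u → s u *P A w u))
      ≈⟨ -‿cong (*-distribˡ-sum (s w) (λ u → s u *P A w u)) ⟩
    -P sum (λ u → s w *P (s u *P A w u))
      ≈⟨ -‿cong (sum-cong-≋ λ u → swap (s w) (s u) (A w u)) ⟩
    -P sum (λ u → s w *P A w u *P s u) ∎
    where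
    sμ : Poly
    sμ = signP (μ l)
    s : Fin (m l) → Poly
    s u = signP (μ′ l u)
    A : Fin (m l) → Fin (m l) → Poly
    A = adjugate (m l) (D l)
    regroup : ∀ σ S t → σ *P S *P -P (σ *P t) ≈ -P ((σ *P σ) *P (t *P S))
    regroup = solve-∀ ℤ[λ]-ACR
    swap : ∀ a b c → a *P (b *P c) ≈ a *P c *P b
    swap = solve-∀ ℤ[λ]-ACR

  clearing-G-to-G : ∀ l j →
    sum (λ w → clearing l w *P -P adjEntry (link j (l , w))) ≈ -P (constP (δ l j) *P N l)
  clearing-G-to-G l j with j Fin.≟ l | l Fin.≟ j
  ... | yes refl | yes _ = begin
      sum (λ w → clearing l w *P -P signP (μ l Sign.* μ′ l w))
        ≈⟨ sum-cong-≋ (λ w → ≈-trans (*P-congˡ (clearing l w) (-‿cong (signP-* (μ l) (μ′ l w))))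
                                     (clearing-*-ownEdge l w)) ⟩
      sum (λ w → -P sum (λ u → s w *P adjugate (m l) (D l) w u *P s u))
        ≈⟨ -‿sum (λ w → sum (λ u → s w *P adjugate (m l) (D l) w u *P s u)) ⟨
      -P sum (λ w → sum (λ u → s w *P adjugate (m l) (D l) w u *P s u))
        ≈⟨ -‿cong (≈-trans (≈-sym (coronalNum-sum (H l))) (≈-sym (*-identityˡ (N l)))) ⟩
      -P (1# *P N l) ∎
    where
    s : Fin (m l) → Poly
    s u = signP (μ′ l u)
  ... | yes j≡l | no  l≢j = ⊥-elim (l≢j (≡.sym j≡l))
  ... | no  j≢l | yes l≡j = ⊥-elim (j≢l (≡.sym l≡j))
  ... | no  _   | no  _   = begin
      sum (λ w → clearing l w *P -P 0#)
        ≈⟨ sum-ε +-monoid _ (λ w → ≈-trans (*P-congˡ (clearing l w) -0#≈0#) (zeroʳ (clearing l w))) ⟩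
      0#
        ≈⟨ zeros (N l) ⟩
      -P (constP (+ 0) *P N l) ∎
    where
    zeros : ∀ x → 0# ≈ -P (constP (+ 0) *P x)
    zeros x = ≈-sym (≈-trans (-‿cong (≈-trans (*P-congʳ x constP-0) (zeroˡ x))) -0#≈0#)

  scale : Fin (n ℕ.+ T) → Poly
  scale x = [ f , const 1# ]′ (splitAt n x)

  scaled : Mat (n ℕ.+ T)
  scaled x y = scale x *P M x y

  cleared : Mat (n ℕ.+ T)
  cleared x y = [ (λ l → scaled x y +P sum (λ t → clearingAt l (decode n m t) *P scaled (n ↑ʳ t) y))
                , (λ _ → scaled x y) ]′ (splitAt n x)

  reduced : Mat n
  reduced l j = f l *P P l j +P -P (constP (δ l j) *P N l)

  private
    scale-↑ˡ : ∀ l → scale (l ↑ˡ T) ≡ f l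
    scale-↑ˡ l = cong [ f , const 1# ]′ (Fin.splitAt-↑ˡ n l T)

    scale-↑ʳ : ∀ t → scale (n ↑ʳ t) ≡ 1#
    scale-↑ʳ t = cong [ f , const 1# ]′ (Fin.splitAt-↑ʳ n T t)

    cleared-↑ˡ : ∀ l y → cleared (l ↑ˡ T) y ≡
                 scaled (l ↑ˡ T) y +P sum (λ t → clearingAt l (decode n m t) *P scaled (n ↑ʳ t) y)
    cleared-↑ˡ l y rewrite Fin.splitAt-↑ˡ n l T = refl

    cleared-↑ʳ : ∀ t y → cleared (n ↑ʳ t) y ≡ scaled (n ↑ʳ t) y
    cleared-↑ʳ t y rewrite Fin.splitAt-↑ʳ n T t = refl

    scaled-↑ʳ : ∀ t y → scaled (n ↑ʳ t) y ≈ M (n ↑ʳ t) y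
    scaled-↑ʳ t y = ≈-trans (*P-congʳ (M (n ↑ʳ t) y) (≈-reflexive (scale-↑ʳ t))) (*-identityˡ (M (n ↑ʳ t) y))

    det-cleared : det (n ℕ.+ T) cleared ≈ det (n ℕ.+ T) scaled
    det-cleared = det-addRowCombinations (n ℕ.+ T) scaled cleared (_↑ˡ T) (n ↑ʳ_) (λ l t → clearingAt l (decode n m t))
      (λ l l′ → Fin.↑ˡ-injective T l l′) (λ l t → ↑ˡ≢↑ʳ l t ∘ ≡.sym) unchanged
      (λ l y → ≈-reflexive (cleared-↑ˡ l y))
      where
      unchanged : ∀ i → (∀ l → i ≢ l ↑ˡ T) → ∀ y → cleared i y ≈ scaled i y
      unchanged i i∉G y with splitAt n i in eq
      ... | inj₁ l = ⊥-elim (i∉G l (≡.sym (Fin.splitAt⁻¹-↑ˡ eq)))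
      ... | inj₂ _ = ≈-refl

    det-scaled : det (n ℕ.+ T) scaled ≈ prod f *P det (n ℕ.+ T) M
    det-scaled = ≈-trans (det-scaleRows (n ℕ.+ T) scale M) (*P-congʳ (det (n ℕ.+ T) M) (begin
      prod scale
        ≈⟨ sum-↑-split *-monoid n T scale ⟩
      prod (λ l → scale (l ↑ˡ T)) *P prod (λ t → scale (n ↑ʳ t))
        ≈⟨ *-cong (prod-cong (≈-reflexive ∘ scale-↑ˡ)) (sum-ε *-monoid _ (≈-reflexive ∘ scale-↑ʳ)) ⟩
      prod f *P 1#
        ≈⟨ *-identityʳ (prod f) ⟩
      prod f ∎))

    cleared-↑ˡ↑ʳ : ∀ l t → cleared (l ↑ˡ T) (n ↑ʳ t) ≈ 0#
    cleared-↑ˡ↑ʳ l t = begin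
      cleared (l ↑ˡ T) (n ↑ʳ t)
        ≈⟨ ≈-reflexive (cleared-↑ˡ l (n ↑ʳ t)) ⟩
      scaled (l ↑ˡ T) (n ↑ʳ t) +P sum (λ z → clearingAt l (decode n m z) *P scaled (n ↑ʳ z) (n ↑ʳ t))
        ≈⟨ +-cong (*-cong (≈-reflexive (scale-↑ˡ l)) (≈-reflexive (M-↑ˡ↑ʳ l t)))
                  (sum-cong-≋ λ z → *P-congˡ (clearingAt l (decode n m z))
                                      (≈-trans (scaled-↑ʳ z (n ↑ʳ t)) (M-↑ʳ↑ʳ z t))) ⟩
      f l *P -P adjEntry (link l (decode n m t))
        +P sum (λ z → clearingAt l (decode n m z) *P blockDiagonal D (decode n m z) (decode n m t))
        ≈⟨ +P-congˡ (f l *P -P adjEntry (link l (decode n m t)))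
                    (sum-clearingAt l (λ p → blockDiagonal D p (decode n m t))) ⟩
      f l *P -P adjEntry (link l (decode n m t)) +P sum (λ w → clearing l w *P blockDiagonal D (l , w) (decode n m t))
        ≈⟨ clearing-G-to-H l (decode n m t) ⟩
      0# ∎

    cleared-↑ˡ↑ˡ : ∀ l j → cleared (l ↑ˡ T) (j ↑ˡ T) ≈ reduced l j
    cleared-↑ˡ↑ˡ l j = begin
      cleared (l ↑ˡ T) (j ↑ˡ T)
        ≈⟨ ≈-reflexive (cleared-↑ˡ l (j ↑ˡ T)) ⟩
      scaled (l ↑ˡ T) (j ↑ˡ T) +P sum (λ z → clearingAt l (decode n m z) *P scaled (n ↑ʳ z) (j ↑ˡ T))
        ≈⟨ +-cong (*-cong (≈-reflexive (scale-↑ˡ l)) (≈-reflexive (M-↑ˡ↑ˡ l j)))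
                  (sum-cong-≋ λ z → *P-congˡ (clearingAt l (decode n m z))
                                      (≈-trans (scaled-↑ʳ z (j ↑ˡ T)) (≈-reflexive (M-↑ʳ↑ˡ z j)))) ⟩
      f l *P P l j +P sum (λ z → clearingAt l (decode n m z) *P -P adjEntry (link j (decode n m z)))
        ≈⟨ +P-congˡ (f l *P P l j) (sum-clearingAt l (λ p → -P adjEntry (link j p))) ⟩
      f l *P P l j +P sum (λ w → clearing l w *P -P adjEntry (link j (l , w)))
        ≈⟨ +P-congˡ (f l *P P l j) (clearing-G-to-G l j) ⟩
      reduced l j ∎

  corona-reduction : prod f *P det (n ℕ.+ T) M ≈ det n reduced *P prod f
  corona-reduction = begin
    prod f *P det (n ℕ.+ T) M
      ≈⟨ det-scaled ⟨
    det (n ℕ.+ T) scaled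
      ≈⟨ det-cleared ⟨
    det (n ℕ.+ T) cleared
      ≈⟨ det-blockLowerTriangular n T cleared cleared-↑ˡ↑ʳ ⟩
    det n (λ i j → cleared (i ↑ˡ T) (j ↑ˡ T)) *P det T (λ s t → cleared (n ↑ʳ s) (n ↑ʳ t))
      ≈⟨ *-cong (det-cong n cleared-↑ˡ↑ˡ) (≈-trans (det-cong T λ s t →
           ≈-trans (≈-reflexive (cleared-↑ʳ s (n ↑ʳ t))) (≈-trans (scaled-↑ʳ s (n ↑ʳ t)) (M-↑ʳ↑ʳ s t)))
           (det-blockDiagonal n m D)) ⟩
    det n reduced *P prod f ∎

degreeAtMost₁-X : ∀ {p} → DegreeAtMost 1 p → p ≈ constP (coeff p 0) +P constP (coeff p 1) *P X
degreeAtMost₁-X {p} p≤1 = mk≋ λ k → ≡.sym (≡.trans (coeff-+P (constP a) (constP b *P X) k)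
  (≡.trans (cong (λ t → coeff (constP a) k ℤ.+ t) (coeff-constP-*P b X k)) (linear k)))
  where
  a b : ℤ
  a = coeff p 0
  b = coeff p 1
  linear : ∀ k → coeff (constP a) k ℤ.+ b ℤ.* coeff X k ≡ coeff p k
  linear zero          = ≡.trans (cong (λ t → a ℤ.+ t) (ℤ.*-zeroʳ b)) (ℤ.+-identityʳ a)
  linear (suc zero)    = ≡.trans (ℤ.+-identityˡ _) (ℤ.*-identityʳ b)
  linear (suc (suc k)) = ≡.trans (ℤ.+-identityˡ _) (≡.trans (ℤ.*-zeroʳ b)
                           (≡.sym (coeff-beyond p≤1 (suc (suc k)) (s≤s (s≤s z≤n)))))

module CommonCoronal {n} (G : SignedGraph n) (m : Fin n → ℕ) (H : (l : Fin n) → SignedGraph (m l))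
  (f₀ N₀ : Poly) (common : ∀ l → coronalNum (H l) *P f₀ ≈ N₀ *P charPoly (H l)) where
  open Corona G m H
  open Homogenisation (f₀ *P X +P -P N₀) f₀

  f₀ⁿ : Poly
  f₀ⁿ = prod {n} (const f₀)

  f₀*reduced : ∀ l j → f₀ *P reduced l j ≈ f l *P hom₁ (P l j)
  f₀*reduced l j = begin
    f₀ *P (f l *P P l j +P -P (c *P N l))
      ≈⟨ distribute f₀ (f l) (P l j) c (N l) ⟩
    f l *P (f₀ *P P l j) +P -P (c *P (N l *P f₀))
      ≈⟨ +P-congˡ (f l *P (f₀ *P P l j)) (-‿cong (*P-congˡ c (common l))) ⟩
    f l *P (f₀ *P P l j) +P -P (c *P (N₀ *P f l))
      ≈⟨ collect f₀ (f l) (P l j) c N₀ ⟩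
    f l *P (f₀ *P P l j +P -P (c *P N₀))
      ≈⟨ *P-congˡ (f l) (+-cong (*P-congˡ f₀ (degreeAtMost₁-X (charMat-degreeAtMost₁ (edge G) l j)))
           (-‿cong (*P-congʳ N₀ (≈-reflexive (cong constP (≡.sym (coeff₁-charMat (edge G) l j))))))) ⟩
    f l *P (f₀ *P (a +P b *P X) +P -P (b *P N₀))
      ≈⟨ *P-congˡ (f l) (homogenised f₀ N₀ a b) ⟩
    f l *P hom₁ (P l j) ∎
    where
    a b c : Poly
    a = constP (coeff (P l j) 0)
    b = constP (coeff (P l j) 1)
    c = constP (δ l j)
    distribute : ∀ f₀ fₗ p c Nₗ →
                 f₀ *P (fₗ *P p +P -P (c *P Nₗ)) ≈ fₗ *P (f₀ *P p) +P -P (c *P (Nₗ *P f₀))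
    distribute = solve-∀ ℤ[λ]-ACR
    collect : ∀ f₀ fₗ p c N₀ →
              fₗ *P (f₀ *P p) +P -P (c *P (N₀ *P fₗ)) ≈ fₗ *P (f₀ *P p +P -P (c *P N₀))
    collect = solve-∀ ℤ[λ]-ACR
    homogenised : ∀ f₀ N₀ a c → f₀ *P (a +P c *P X) +P -P (c *P N₀) ≈ a *P f₀ +P c *P (f₀ *P X +P -P N₀)
    homogenised = solve-∀ ℤ[λ]-ACR

  det-reduced : f₀ⁿ *P det n reduced ≈ prod f *P homP n (charPoly G)
  det-reduced = begin
    f₀ⁿ *P det n reduced                    ≈⟨ det-scaleRows n (const f₀) reduced ⟨
    det n (λ l j → f₀ *P reduced l j)       ≈⟨ det-cong n f₀*reduced ⟩
    det n (λ l j → f l *P hom₁ (P l j))     ≈⟨ det-scaleRows n f (λ l j → hom₁ (P l j)) ⟩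
    prod f *P det n (λ l j → hom₁ (P l j))  ≈⟨ *P-congˡ (prod f) (det-hom₁ (f₀ *P X +P -P N₀) f₀ n P
                                                (charMat-degreeAtMost₁ (edge G))) ⟩
    prod f *P homP n (charPoly G)           ∎

  corona-charPoly : (f₀ⁿ *P prod f) *P charPolyE (coronaEdges G m H) ≈
                    (prod f *P homP n (charPoly G)) *P prod f
  corona-charPoly = begin
    (f₀ⁿ *P prod f) *P det (n ℕ.+ T) M         ≈⟨ *-assoc f₀ⁿ (prod f) (det (n ℕ.+ T) M) ⟩
    f₀ⁿ *P (prod f *P det (n ℕ.+ T) M)         ≈⟨ *P-congˡ f₀ⁿ corona-reduction ⟩
    f₀ⁿ *P (det n reduced *P prod f)           ≈⟨ *-assoc f₀ⁿ (det n reduced) (prod f) ⟨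
    (f₀ⁿ *P det n reduced) *P prod f           ≈⟨ *P-congʳ (prod f) det-reduced ⟩
    (prod f *P homP n (charPoly G)) *P prod f  ∎

mainTheorem15 : ∀ (n : ℕ) (G′ G″ : SignedGraph n) (m : Fin n → ℕ)
                  (H : (l : Fin n) → SignedGraph (m l))
                → Cospectral G′ G″
                → (∀ i j → SameCoronal (H i) (H j))
                → CospectralE (coronaEdges G′ m H) (coronaEdges G″ m H)
mainTheorem15 zero    G′ G″ m H _          _    = λ _ → refl
mainTheorem15 (suc n) G′ G″ m H cospectral same = coeff-≡ (*P-cancelˡ-monic q-monic (begin
  q *P charPolyE (coronaEdges G′ m H)                ≈⟨ C′.corona-charPoly ⟩
  (prod f *P homP (suc n) (charPoly G′)) *P prod f   ≈⟨ *P-congʳ (prod f) (*P-congˡ (prod f)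
                                                          (homP-cong (suc n) cospectral′)) ⟩
  (prod f *P homP (suc n) (charPoly G″)) *P prod f   ≈⟨ C″.corona-charPoly ⟨
  q *P charPolyE (coronaEdges G″ m H)                ∎))
  where
  f : Fin (suc n) → Poly
  f l = charPoly (H l)
  N₀ : Poly
  N₀ = coronalNum (H zero)
  cospectral′ : charPoly G′ ≈ charPoly G″
  cospectral′ = mk≋ cospectral
  common : ∀ l → coronalNum (H l) *P f zero ≈ N₀ *P f l
  common l = mk≋ (same l zero)
  open Homogenisation (f zero *P X +P -P N₀) (f zero)
  module C′ = CommonCoronal G′ m H (f zero) N₀ common
  module C″ = CommonCoronal G″ m H (f zero) N₀ common
  q : Poly
  q = prod {suc n} (const (f zero)) *P prod f
  q-monic : IsMonic q
  q-monic = isMonic-*P (isMonic-prod {suc n} (const (f zero)) (λ _ → f-monic zero)) (isMonic-prod f f-monic)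
    where
    f-monic : ∀ l → IsMonic (f l)
    f-monic l = m l , charPolyE-monic (m l) (edge (H l))
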